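{- Let $n,r,\ell,\Delta \geq 1$ be integers and $\beta>0$ with $0 < 1/n \ll 1/r,1/\ell,1/\Delta,\beta$. Let $H$ be a graph on $n$ vertices with $\Delta(H) \leq \Delta$ and $\chi(H)\le r$, and let $x_1,\ldots,x_n$ be a labelling of $V(H)$ of bandwidth at most $\beta n$. Suppose $\{ m_{i,j} : (i,j)\in[\ell]\times[2r]\}$ are such that $\sum_{(i,j) \in [\ell]\times[2r]}m_{i,j}=n$, $m_{i,j} \geq 10\beta n$ for all $(i,j)$, and $|m_{i,j}-m_{i,j'}| \leq 1$ whenever $i \in [\ell]$ and $j,j'\in[2r]$. Let $\chi : V(H) \rightarrow [r]$ be a proper colouring of $H$. Then there exist a mapping $f:V(H)\rightarrow [\ell]\times[2r]$ and a set $B \subseteq V(H)$ such that: (B1) $B \cap \{ x_1,\ldots,x_{\beta n}\} = \emptyset$ and $|B| \leq 2\ell\beta n$; (B2) $\left| |f^{ -1}(i,j)| - m_{i,j}\right| \leq 10\beta n$ for every $(i,j) \in [\ell]\times[2r]$; (B3) for every edge $uv\in E(H)$, writing $f(u)=(i,j)$ and $f(v)=(i',j')$, we have $|i-i'|\leq 1$ and $j \neq j'$; if additionally $u,v \notin B$, then $i=i'$; (B4) for all $s \leq \beta n$ we have $f(x_s)=(1,\chi(x_s))$. In particular, $f$ is a graph homomorphism from $H$ to $Z^{2r}_{\ell}$.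
   Context: A labelling $x_1,\dots,x_n$ of $V(H)$ has bandwidth at most $b$ if $|i-j|\le b$ for every edge $x_ix_j$. $Z^k_\ell$ is the graph with vertex set $[\ell]\times[k]$ in which $(i,j)(i',j')$ is an edge whenever $j\ne j'$ and either $|i-i'|\le1$ or $\{i,i'\}=\{1,\ell\}$. A graph homomorphism $f:V(H)\to V(F)$ maps edges to edges. Floors and ceilings (e.g. of $\beta n$) are ignored. Hierarchy convention: the statement holds for $n$ sufficiently large in terms of $r,\ell,\Delta,\beta$.
   Formalization: The parameter β ranges over the positive rationals. -}

module Defs where

open import Data.Nat using (ℕ; suc; _+_; _*_; _≤_; ∣_-_∣)
open import Data.Nat.Properties using (m≤m+n)
open import Data.Bool using (Bool; true; false; T)
open import Data.Fin using (Fin; toℕ; inject≤; zero)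
open import Data.Fin.Subset using (Subset; _∈_; _∉_; ∣_∣)
open import Data.List using (List; length; filter; map; allFin)
open import Data.Nat.ListAction using (sum)
open import Data.Product using (_×_; _,_)
open import Data.Product.Properties using (≡-dec)
import Data.Fin.Properties as FinP
open import Data.Integer using (+_)
open import Data.Rational using (ℚ; _/_) renaming (_≤_ to _≤ℚ_)
open import Relation.Binary.PropositionalEquality using (_≡_)
open import Relation.Nullary using (¬_)
open import Relation.Nullary.Decidable using (Dec)

⟦_⟧ : ℕ → ℚ
⟦ n ⟧ = + n / 1

ΣFin : (k : ℕ) → (Fin k → ℕ) → ℕ
ΣFin k f = sum (map f (allFin k))

record Graph (n : ℕ) : Set where
  field
    adj   : Fin n → Fin n → Bool
    sym   : ∀ u v → adj u v ≡ adj v u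
    irrefl : ∀ v → adj v v ≡ false

open Graph public

Edge : ∀ {n} → Graph n → Fin n → Fin n → Set
Edge H u v = T (adj H u v)

degree : ∀ {n} → Graph n → Fin n → ℕ
degree {n} H v = length (filter (λ u → Data.Bool._≟_ (adj H v u) true) (allFin n))
  where import Data.Bool

MaxDegree≤ : ∀ {n} → Graph n → ℕ → Set
MaxDegree≤ H Δ = ∀ v → degree H v ≤ Δ

ProperColouring : ∀ {n} → Graph n → (r : ℕ) → (Fin n → Fin r) → Set
ProperColouring H r c = ∀ u v → Edge H u v → ¬ (c u ≡ c v)

-- the vertex labelled x_{s+1} is the vertex (s : Fin n); bandwidth of this labelling ≤ b (rational)
BandwidthAtMost : ∀ {n} → Graph n → ℚ → Set
BandwidthAtMost H b = ∀ u v → Edge H u v → ⟦ ∣ toℕ u - toℕ v ∣ ⟧ ≤ℚ b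

preimageSize : ∀ {n ℓ k} → (Fin n → Fin ℓ × Fin k) → Fin ℓ × Fin k → ℕ
preimageSize {n} f p = length (filter (λ v → ≡-dec FinP._≟_ FinP._≟_ (f v) p) (allFin n))

embCol : ∀ {r} → Fin r → Fin (2 * r)
embCol {r} c = inject≤ c (m≤m+n r (r + 0))

module Submission where

-- Let L = ⌊βn⌋ ≥ 1 and cut the vertex order into blocks of L
-- consecutive vertices, so every edge lies inside a block or joins adjacent
-- blocks.  Rows: with prefix masses R i = Σ_{i′<i} Σ_j m i′ j, row i consists
-- of the blocks from ⌊R i / L⌋ on; a row changes between adjacent blocks only
-- at the (at most ℓ) blocks that open a row, and B is their union (B1, B3).
-- Columns: blocks of even index use the first half of the 2r columns and
-- blocks of odd index the second half, so adjacent blocks never share a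
-- column; inside a block, colour c goes to slot σ⁻¹ c, where the permutation σ
-- is chosen greedily against the slot counts accumulated so far, keeping all
-- slots of a half L-balanced (B3, B4).  Counting gives (B2) with error 4L.

open import Data.Nat using (ℕ; zero; suc; _+_; _*_; _≤_; _≥_; ∣_-_∣; NonZero)
open import Data.Fin using (Fin; toℕ)
open import Data.Fin.Subset using (Subset; _∉_; ∣_∣)
open import Data.Product using (Σ; _×_; _,_; proj₁; proj₂)
open import Data.Rational using (ℚ; 0ℚ; 1ℚ) renaming (_<_ to _<ℚ_; _≤_ to _≤ℚ_; _*_ to _·_)
open import Relation.Binary.PropositionalEquality using (_≡_)
open import Relation.Nullary using (¬_; Dec; yes; no)
open import Defs hiding (sym)

module IntervalSums where

  open import Data.Nat
  open import Data.Nat.Properties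
  open import Data.Bool using (Bool; true; false; _∧_)
  open import Relation.Binary.PropositionalEquality
  open import Relation.Nullary using (¬_)
  open import Data.Product using (_×_; _,_; proj₁; proj₂)
  open import Data.Empty using (⊥-elim)
  open import Function using (_∘_)
  open ≡-Reasoning

  sumFrom : (ℕ → ℕ) → ℕ → ℕ → ℕ
  sumFrom h a zero    = 0
  sumFrom h a (suc k) = h a + sumFrom h (suc a) k

  𝟙 : Bool → ℕ
  𝟙 true  = 1
  𝟙 false = 0

  countFrom : (ℕ → Bool) → ℕ → ℕ → ℕ
  countFrom P = sumFrom (𝟙 ∘ P)

  keepIf : Bool → ℕ → ℕ
  keepIf true  x = x
  keepIf false _ = 0

  sumFrom-++ : ∀ h a x y → sumFrom h a (x + y) ≡ sumFrom h a x + sumFrom h (a + x) y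
  sumFrom-++ h a zero    y = cong (λ z → sumFrom h z y) (sym (+-identityʳ a))
  sumFrom-++ h a (suc x) y = begin
      h a + sumFrom h (suc a) (x + y)                            ≡⟨ cong (h a +_) (sumFrom-++ h (suc a) x y) ⟩
      h a + (sumFrom h (suc a) x + sumFrom h (suc a + x) y)      ≡⟨ sym (+-assoc (h a) _ _) ⟩
      h a + sumFrom h (suc a) x + sumFrom h (suc a + x) y        ≡⟨ cong (λ z → h a + sumFrom h (suc a) x + sumFrom h z y) (sym (+-suc a x)) ⟩
      h a + sumFrom h (suc a) x + sumFrom h (a + suc x) y        ∎

  sumFrom-prefix : ∀ h a {k k′} → k ≤ k′ → sumFrom h a k ≤ sumFrom h a k′
  sumFrom-prefix h a {k} {k′} k≤k′ = subst (sumFrom h a k ≤_)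
    (trans (sym (sumFrom-++ h a k (k′ ∸ k))) (cong (sumFrom h a) (m+[n∸m]≡n k≤k′))) (m≤m+n _ _)

  sumFrom-snoc : ∀ h a k → sumFrom h a (suc k) ≡ sumFrom h a k + h (a + k)
  sumFrom-snoc h a k = begin
      sumFrom h a (suc k)                  ≡⟨ cong (sumFrom h a) (+-comm 1 k) ⟩
      sumFrom h a (k + 1)                  ≡⟨ sumFrom-++ h a k 1 ⟩
      sumFrom h a k + (h (a + k) + 0)      ≡⟨ cong (sumFrom h a k +_) (+-identityʳ _) ⟩
      sumFrom h a k + h (a + k)            ∎

  sumFrom-cong : ∀ {h₁ h₂} a k → (∀ p → a ≤ p → p < a + k → h₁ p ≡ h₂ p) → sumFrom h₁ a k ≡ sumFrom h₂ a k
  sumFrom-cong a zero    eq = refl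
  sumFrom-cong a (suc k) eq = cong₂ _+_ (eq a ≤-refl (m<m+n a (s≤s z≤n)))
    (sumFrom-cong (suc a) k (λ p a<p p<end → eq p (<⇒≤ a<p) (subst (p <_) (sym (+-suc a k)) p<end)))

  sumFrom-+ : ∀ h₁ h₂ a k → sumFrom (λ p → h₁ p + h₂ p) a k ≡ sumFrom h₁ a k + sumFrom h₂ a k
  sumFrom-+ h₁ h₂ a zero    = refl
  sumFrom-+ h₁ h₂ a (suc k) = begin
      h₁ a + h₂ a + sumFrom (λ p → h₁ p + h₂ p) (suc a) k       ≡⟨ cong (h₁ a + h₂ a +_) (sumFrom-+ h₁ h₂ (suc a) k) ⟩
      h₁ a + h₂ a + (sumFrom h₁ (suc a) k + sumFrom h₂ (suc a) k) ≡⟨ +-assoc (h₁ a) (h₂ a) _ ⟩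
      h₁ a + (h₂ a + (sumFrom h₁ (suc a) k + sumFrom h₂ (suc a) k)) ≡⟨ cong (h₁ a +_) (x+[y+z]≡y+[x+z] (h₂ a) (sumFrom h₁ (suc a) k) _) ⟩
      h₁ a + (sumFrom h₁ (suc a) k + (h₂ a + sumFrom h₂ (suc a) k)) ≡⟨ sym (+-assoc (h₁ a) _ _) ⟩
      h₁ a + sumFrom h₁ (suc a) k + (h₂ a + sumFrom h₂ (suc a) k) ∎
    where
    x+[y+z]≡y+[x+z] : ∀ x y z → x + (y + z) ≡ y + (x + z)
    x+[y+z]≡y+[x+z] x y z = trans (sym (+-assoc x y z)) (trans (cong (_+ z) (+-comm x y)) (+-assoc y x z))

  sumFrom-const : ∀ c a k → sumFrom (λ _ → c) a k ≡ k * c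
  sumFrom-const c a zero    = refl
  sumFrom-const c a (suc k) = cong (c +_) (sumFrom-const c (suc a) k)

  sumFrom-*ˡ : ∀ c h a k → sumFrom (λ p → c * h p) a k ≡ c * sumFrom h a k
  sumFrom-*ˡ c h a zero    = sym (*-zeroʳ c)
  sumFrom-*ˡ c h a (suc k) = trans (cong (c * h a +_) (sumFrom-*ˡ c h (suc a) k)) (sym (*-distribˡ-+ c (h a) _))

  sumFrom-zero : ∀ h a k → (∀ p → h p ≡ 0) → sumFrom h a k ≡ 0
  sumFrom-zero h a zero    eq = refl
  sumFrom-zero h a (suc k) eq = cong₂ _+_ (eq a) (sumFrom-zero h (suc a) k eq)

  sumFrom-zero-tail : ∀ h a {k k′} → k ≤ k′ → (∀ p → a + k ≤ p → h p ≡ 0) → sumFrom h a k′ ≡ sumFrom h a k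
  sumFrom-zero-tail h a {k} {k′} k≤k′ vanish = begin
      sumFrom h a k′                                    ≡⟨ cong (sumFrom h a) (sym (m+[n∸m]≡n k≤k′)) ⟩
      sumFrom h a (k + (k′ ∸ k))                        ≡⟨ sumFrom-++ h a k (k′ ∸ k) ⟩
      sumFrom h a k + sumFrom h (a + k) (k′ ∸ k)        ≡⟨ cong (sumFrom h a k +_) (sumFrom-cong (a + k) (k′ ∸ k) (λ p a+k≤p _ → vanish p a+k≤p)) ⟩
      sumFrom h a k + sumFrom (λ _ → 0) (a + k) (k′ ∸ k) ≡⟨ cong (sumFrom h a k +_) (sumFrom-zero _ (a + k) (k′ ∸ k) (λ _ → refl)) ⟩
      sumFrom h a k + 0                                 ≡⟨ +-identityʳ _ ⟩
      sumFrom h a k                                     ∎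

  sumFrom-swap : ∀ (h : ℕ → ℕ → ℕ) a A b B →
    sumFrom (λ y → sumFrom (λ x → h x y) a A) b B ≡ sumFrom (λ x → sumFrom (h x) b B) a A
  sumFrom-swap h a zero    b B = sumFrom-zero _ b B (λ _ → refl)
  sumFrom-swap h a (suc A) b B = trans (sumFrom-+ (h a) (λ y → sumFrom (λ x → h x y) (suc a) A) b B)
    (cong (sumFrom (h a) b B +_) (sumFrom-swap h (suc a) A b B))

  sumFrom-keepIf : ∀ c h a k → sumFrom (λ p → keepIf c (h p)) a k ≡ keepIf c (sumFrom h a k)
  sumFrom-keepIf true  h a k = refl
  sumFrom-keepIf false h a k = sumFrom-zero _ a k (λ _ → refl)

  sumFrom-blocks : ∀ L h a k → sumFrom h (a * L) (k * L) ≡ sumFrom (λ t → sumFrom h (t * L) L) a k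
  sumFrom-blocks L h a zero    = refl
  sumFrom-blocks L h a (suc k) = trans (sumFrom-++ h (a * L) L (k * L))
    (cong (sumFrom h (a * L) L +_) (trans (cong (λ z → sumFrom h z (k * L)) (+-comm (a * L) L)) (sumFrom-blocks L h (suc a) k)))

  sumFrom-shift : ∀ h a k → sumFrom h (suc a) k ≡ sumFrom (h ∘ suc) a k
  sumFrom-shift h a zero    = refl
  sumFrom-shift h a (suc k) = cong (h (suc a) +_) (sumFrom-shift h (suc a) k)

  countFrom-∧ : ∀ c P a k → countFrom (λ p → c ∧ P p) a k ≡ keepIf c (countFrom P a k)
  countFrom-∧ true  P a k = refl
  countFrom-∧ false P a k = sumFrom-zero _ a k (λ _ → refl)

  𝟙≤1 : ∀ b → 𝟙 b ≤ 1
  𝟙≤1 true  = ≤-refl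
  𝟙≤1 false = z≤n

  countFrom≤ : ∀ P a k → countFrom P a k ≤ k
  countFrom≤ P a zero    = z≤n
  countFrom≤ P a (suc k) = +-mono-≤ (𝟙≤1 (P a)) (countFrom≤ P (suc a) k)

  count-below : ∀ N a k → countFrom (_<ᵇ N) a k ≡ k ⊓ (N ∸ a)
  count-below N       a       zero    = refl
  count-below zero    a       (suc k) = trans (count-below zero (suc a) k)
    (trans (⊓-zeroʳ k) (sym (trans (cong (suc k ⊓_) (0∸n≡0 a)) (⊓-zeroʳ (suc k)))))
  count-below (suc N) zero    (suc k) = cong suc (trans (sumFrom-shift _ 0 k) (count-below N 0 k))
  count-below (suc N) (suc a) (suc k) = trans (sumFrom-shift (𝟙 ∘ (_<ᵇ suc N)) a (suc k)) (count-below N a (suc k))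

  sumFrom-select : ∀ (P : ℕ → Bool) G a b N → a ≤ b → b ≤ N →
    (∀ t → t < N → P t ≡ true → a ≤ t × t < b) → (∀ t → a ≤ t → t < b → P t ≡ true) →
    sumFrom (λ t → keepIf (P t) (G t)) 0 N ≡ sumFrom G a (b ∸ a)
  sumFrom-select P G a b N a≤b b≤N onlyInside inside = begin
      sumFrom F 0 N                                                   ≡⟨ cong (sumFrom F 0) (sym split) ⟩
      sumFrom F 0 (a + (b ∸ a) + (N ∸ b))                             ≡⟨ sumFrom-++ F 0 (a + (b ∸ a)) (N ∸ b) ⟩
      sumFrom F 0 (a + (b ∸ a)) + sumFrom F (a + (b ∸ a)) (N ∸ b)     ≡⟨ cong₂ _+_ (sumFrom-++ F 0 a (b ∸ a)) (sumFrom-cong _ (N ∸ b) after) ⟩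
      sumFrom F 0 a + sumFrom F a (b ∸ a) + sumFrom (λ _ → 0) _ (N ∸ b) ≡⟨ cong₂ _+_ (cong₂ _+_ (trans (sumFrom-cong 0 a before) (sumFrom-zero _ 0 a (λ _ → refl))) (sumFrom-cong a (b ∸ a) middle)) (sumFrom-zero _ _ (N ∸ b) (λ _ → refl)) ⟩
      0 + sumFrom G a (b ∸ a) + 0                                     ≡⟨ +-identityʳ _ ⟩
      sumFrom G a (b ∸ a)                                             ∎
    where
    F : ℕ → ℕ
    F t = keepIf (P t) (G t)
    split : a + (b ∸ a) + (N ∸ b) ≡ N
    split = trans (cong (_+ (N ∸ b)) (m+[n∸m]≡n a≤b)) (m+[n∸m]≡n b≤N)
    notSelected : ∀ t → ¬ (P t ≡ true) → F t ≡ 0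
    notSelected t ¬Pt with P t
    ... | true  = ⊥-elim (¬Pt refl)
    ... | false = refl
    before : ∀ t → 0 ≤ t → t < 0 + a → F t ≡ 0
    before t _ t<a = notSelected t (λ Pt → <⇒≱ t<a (proj₁ (onlyInside t (<-≤-trans t<a (≤-trans a≤b b≤N)) Pt)))
    after : ∀ t → a + (b ∸ a) ≤ t → t < a + (b ∸ a) + (N ∸ b) → F t ≡ 0
    after t b≤t t<N = notSelected t (λ Pt → <⇒≱ (proj₂ (onlyInside t (subst (t <_) split t<N) Pt)) (subst (_≤ t) (m+[n∸m]≡n a≤b) b≤t))
    middle : ∀ t → a ≤ t → t < a + (b ∸ a) → F t ≡ G t
    middle t a≤t t<b rewrite inside t a≤t (subst (t <_) (m+[n∸m]≡n a≤b) t<b) = refl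

-- Translating sums and counts indexed by Fin k (as they appear in the
-- statement) into interval sums over ℕ.
module FinSums where

  open import Data.Nat hiding (_≟_)
  open import Data.Nat.Properties hiding (_≟_)
  open import Data.Bool using (Bool; true; false)
  import Data.Bool as Bool
  open import Data.Fin using (Fin; toℕ; zero; suc)
  open import Data.Fin.Properties using (_≟_)
  open import Data.List using (_∷_; map; tabulate; allFin; filter; length)
  open import Data.Nat.ListAction using (sum)
  import Data.List.Properties as ListP
  import Data.Vec as Vec
  open import Relation.Binary.PropositionalEquality
  open import Relation.Nullary using (Dec; does)
  open import Function using (_∘_; id)
  open IntervalSums

  sum-tabulate : ∀ k (g : Fin k → ℕ) h a → (∀ i → g i ≡ h (a + toℕ i)) → sum (tabulate g) ≡ sumFrom h a k
  sum-tabulate zero    g h a eq = refl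
  sum-tabulate (suc k) g h a eq = cong₂ _+_ (trans (eq zero) (cong h (+-identityʳ a)))
    (sum-tabulate k (g ∘ suc) h (suc a) (λ i → trans (eq (suc i)) (cong h (+-suc a (toℕ i)))))

  clamp : (l : ℕ) → ℕ → Fin (suc l)
  clamp zero    _       = zero
  clamp (suc l) zero    = zero
  clamp (suc l) (suc i) = suc (clamp l i)

  clamp-toℕ : ∀ l (i : Fin (suc l)) → clamp l (toℕ i) ≡ i
  clamp-toℕ zero    zero    = refl
  clamp-toℕ (suc l) zero    = refl
  clamp-toℕ (suc l) (suc i) = cong suc (clamp-toℕ l i)

  toℕ-clamp : ∀ l i → i ≤ l → toℕ (clamp l i) ≡ i
  toℕ-clamp zero    zero    _         = refl
  toℕ-clamp (suc l) zero    _         = refl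
  toℕ-clamp (suc l) (suc i) (s≤s i≤l) = cong suc (toℕ-clamp l i i≤l)

  sumFin-clamp : ∀ l (g : Fin (suc l) → ℕ) → sum (map g (allFin (suc l))) ≡ sumFrom (g ∘ clamp l) 0 (suc l)
  sumFin-clamp l g = trans (cong sum (ListP.map-tabulate id g))
    (sum-tabulate (suc l) g (g ∘ clamp l) 0 (λ i → cong g (sym (clamp-toℕ l i))))

  one-hot : ∀ l (x : Fin (suc l)) → sumFrom (λ k → 𝟙 (does (x ≟ clamp l k))) 0 (suc l) ≡ 1
  one-hot zero    zero    = refl
  one-hot (suc l) zero    = cong suc (trans (sumFrom-shift (λ k → 𝟙 (does (zero ≟ clamp (suc l) k))) 0 (suc l))
                                              (sumFrom-zero _ 0 (suc l) (λ _ → refl)))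
  one-hot (suc l) (suc x) = trans (sumFrom-shift (λ k → 𝟙 (does (suc x ≟ clamp (suc l) k))) 0 (suc l)) (one-hot l x)

  length-filter-∷ : ∀ {A : Set} {P : A → Set} (P? : ∀ x → Dec (P x)) x xs →
    length (filter P? (x ∷ xs)) ≡ 𝟙 (does (P? x)) + length (filter P? xs)
  length-filter-∷ P? x xs with does (P? x)
  ... | true  = refl
  ... | false = refl

  count-∷ : ∀ {k} b (v : Vec.Vec Bool k) → Vec.count (Bool._≟ true) (b Vec.∷ v) ≡ 𝟙 b + Vec.count (Bool._≟ true) v
  count-∷ true  v = refl
  count-∷ false v = refl

  length-filter-tabulate : ∀ {A : Set} {P : A → Set} (P? : ∀ x → Dec (P x)) k (g : Fin k → A) h a →
    (∀ i → does (P? (g i)) ≡ h (a + toℕ i)) → length (filter P? (tabulate g)) ≡ countFrom h a k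
  length-filter-tabulate P? zero    g h a eq = refl
  length-filter-tabulate P? (suc k) g h a eq = trans (length-filter-∷ P? (g zero) (tabulate (g ∘ suc)))
    (cong₂ _+_ (cong 𝟙 (trans (eq zero) (cong h (+-identityʳ a))))
      (length-filter-tabulate P? k (g ∘ suc) h (suc a) (λ i → trans (eq (suc i)) (cong h (+-suc a (toℕ i))))))

  count-tabulate : ∀ k (g : Fin k → Bool) h a → (∀ i → g i ≡ h (a + toℕ i)) →
    Vec.count (Bool._≟ true) (Vec.tabulate g) ≡ countFrom h a k
  count-tabulate zero    g h a eq = refl
  count-tabulate (suc k) g h a eq = trans (count-∷ (g zero) (Vec.tabulate (g ∘ suc)))
    (cong₂ _+_ (cong 𝟙 (trans (eq zero) (cong h (+-identityʳ a))))
      (count-tabulate k (g ∘ suc) h (suc a) (λ i → trans (eq (suc i)) (cong h (+-suc a (toℕ i))))))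

-- This is the greedy step that keeps colour counts balanced.
module AntiSort where

  open import Data.Nat hiding (_≟_)
  open import Data.Nat.Properties hiding (_≟_)
  open import Data.Fin using (Fin; zero; suc; punchIn; punchOut)
  open import Data.Fin.Properties using (punchIn-punchOut; _≟_)
  open import Data.Fin.Permutation using (Permutation′; insert; _⟨$⟩ʳ_; insert-punchIn) renaming (id to idPerm)
  open import Data.Product using (Σ; _,_; proj₁; proj₂)
  open import Data.Sum using (_⊎_; inj₁; inj₂)
  open import Relation.Binary.PropositionalEquality
  open import Relation.Nullary using (yes; no)
  open import Relation.Nullary.Decidable using (dec-yes)
  open import Data.Empty using (⊥-elim)
  open import Function using (_∘_)

  argmax : ∀ {r} (C : Fin (suc r) → ℕ) → Σ (Fin (suc r)) λ i → ∀ k → C k ≤ C i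
  argmax {zero}  C = zero , λ { zero → ≤-refl }
  argmax {suc r} C with argmax (C ∘ suc)
  ... | i , max with C zero ≤? C (suc i)
  ... | yes C0≤ = suc i , λ { zero → C0≤ ; (suc k) → max k }
  ... | no  C0≰ = zero  , λ { zero → ≤-refl ; (suc k) → ≤-trans (max k) (<⇒≤ (≰⇒> C0≰)) }

  argmin : ∀ {r} (C : Fin (suc r) → ℕ) → Σ (Fin (suc r)) λ i → ∀ k → C i ≤ C k
  argmin {zero}  C = zero , λ { zero → ≤-refl }
  argmin {suc r} C with argmin (C ∘ suc)
  ... | i , min with C (suc i) ≤? C zero
  ... | yes ≤C0 = suc i , λ { zero → ≤C0 ; (suc k) → min k }
  ... | no  ≰C0 = zero  , λ { zero → ≤-refl ; (suc k) → ≤-trans (<⇒≤ (≰⇒> ≰C0)) (min k) }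

  AntiSorted : ∀ {r} → (C d : Fin r → ℕ) → Permutation′ r → Set
  AntiSorted C d σ = ∀ k k′ → C k′ < C k → d (σ ⟨$⟩ʳ k) ≤ d (σ ⟨$⟩ʳ k′)

  punchIn-view : ∀ {m} (i k : Fin (suc m)) → (i ≡ k) ⊎ Σ (Fin m) (λ a → punchIn i a ≡ k)
  punchIn-view i k with i ≟ k
  ... | yes i≡k = inj₁ i≡k
  ... | no  i≢k = inj₂ (punchOut i≢k , punchIn-punchOut i≢k)

  insert-at : ∀ {m} (i j : Fin (suc m)) (π : Permutation′ m) → insert i j π ⟨$⟩ʳ i ≡ j
  insert-at i j π rewrite proj₂ (dec-yes (i ≟ i) refl) = refl

  antiSort : ∀ r (C d : Fin r → ℕ) → Σ (Permutation′ r) (AntiSorted C d)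
  antiSort zero    C d = idPerm , λ ()
  antiSort (suc r) C d = insert i j σ , antiSorted
    where
    i : Fin (suc r)
    i = proj₁ (argmax C)
    j : Fin (suc r)
    j = proj₁ (argmin d)
    rest : Σ (Permutation′ r) (AntiSorted (C ∘ punchIn i) (d ∘ punchIn j))
    rest = antiSort r (C ∘ punchIn i) (d ∘ punchIn j)
    σ : Permutation′ r
    σ = proj₁ rest
    antiSorted : AntiSorted C d (insert i j σ)
    antiSorted k k′ C′<C with punchIn-view i k | punchIn-view i k′
    ... | inj₁ refl        | _                  = subst (λ z → d z ≤ d (insert i j σ ⟨$⟩ʳ k′)) (sym (insert-at i j σ)) (proj₂ (argmin d) _)
    ... | inj₂ _           | inj₁ refl          = ⊥-elim (<⇒≱ C′<C (proj₂ (argmax C) k))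
    ... | inj₂ (a , refl)  | inj₂ (a′ , refl)   =
          subst₂ (λ x y → d x ≤ d y) (sym (insert-punchIn i j σ a)) (sym (insert-punchIn i j σ a′)) (proj₂ rest a a′ C′<C)

module NatInRationals where

  open import Data.Nat as ℕ using (zero; suc; z≤n)
  import Data.Nat.Properties as ℕP
  open import Data.Nat.Divisibility using (∣1⇒≡1)
  open import Data.Nat.Coprimality using (Coprime)
  open import Data.Integer as ℤ using (+_; +[1+_]; -[1+_])
  import Data.Integer.Properties as ℤP
  open import Data.Rational using (mkℚ; toℚᵘ; *<*; nonNegative; positive)
  open import Data.Rational.Properties
  import Data.Rational.Unnormalised as ℚᵘ
  import Data.Rational.Unnormalised.Properties as ℚᵘP
  open import Data.Product using (Σ; _,_)
  open import Relation.Binary.PropositionalEquality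
  open import Data.Empty using (⊥-elim)

  toℚᵘ-⟦⟧ : ∀ n → toℚᵘ ⟦ n ⟧ ≡ ℚᵘ.mkℚᵘ (+ n) 0
  toℚᵘ-⟦⟧ n = cong toℚᵘ (normalize-coprime coprime-1)
    where
    coprime-1 : Coprime n 1
    coprime-1 (_ , d∣1) = ∣1⇒≡1 d∣1

  ⟦⟧-mono : ∀ {a b} → a ℕ.≤ b → ⟦ a ⟧ ≤ℚ ⟦ b ⟧
  ⟦⟧-mono {a} {b} a≤b = toℚᵘ-cancel-≤ (subst₂ ℚᵘ._≤_ (sym (toℚᵘ-⟦⟧ a)) (sym (toℚᵘ-⟦⟧ b))
    (ℚᵘ.*≤* (subst₂ ℤ._≤_ (sym (ℤP.*-identityʳ (+ a))) (sym (ℤP.*-identityʳ (+ b))) (ℤ.+≤+ a≤b))))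

  ⟦⟧-cancel : ∀ {a b} → ⟦ a ⟧ ≤ℚ ⟦ b ⟧ → a ℕ.≤ b
  ⟦⟧-cancel {a} {b} a≤b with subst₂ ℚᵘ._≤_ (toℚᵘ-⟦⟧ a) (toℚᵘ-⟦⟧ b) (toℚᵘ-mono-≤ a≤b)
  ... | ℚᵘ.*≤* a·1≤b·1 with subst₂ ℤ._≤_ (ℤP.*-identityʳ (+ a)) (ℤP.*-identityʳ (+ b)) a·1≤b·1
  ... | ℤ.+≤+ a≤b′ = a≤b′

  ⟦⟧-* : ∀ a b → ⟦ a ℕ.* b ⟧ ≡ ⟦ a ⟧ · ⟦ b ⟧
  ⟦⟧-* a b = toℚᵘ-injective (ℚᵘP.≃-trans inℚᵘ (ℚᵘP.≃-sym (toℚᵘ-homo-* ⟦ a ⟧ ⟦ b ⟧)))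
    where
    inℚᵘ : toℚᵘ ⟦ a ℕ.* b ⟧ ℚᵘ.≃ (toℚᵘ ⟦ a ⟧ ℚᵘ.* toℚᵘ ⟦ b ⟧)
    inℚᵘ rewrite toℚᵘ-⟦⟧ (a ℕ.* b) | toℚᵘ-⟦⟧ a | toℚᵘ-⟦⟧ b = ℚᵘ.*≡* (cong (ℤ._* + 1) (ℤP.pos-* a b))

  ⟦⟧-nonNeg : ∀ n → 0ℚ ≤ℚ ⟦ n ⟧
  ⟦⟧-nonNeg n = ⟦⟧-mono {0} {n} z≤n

  *⟦⟧-nonNeg : ∀ β n → 0ℚ <ℚ β → 0ℚ ≤ℚ β · ⟦ n ⟧
  *⟦⟧-nonNeg β n 0<β = begin
      0ℚ          ≡⟨ sym (*-zeroˡ ⟦ n ⟧) ⟩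
      0ℚ · ⟦ n ⟧  ≤⟨ *-monoʳ-≤-nonNeg ⟦ n ⟧ {{nonNegative (⟦⟧-nonNeg n)}} (<⇒≤ 0<β) ⟩
      β · ⟦ n ⟧   ∎
    where open ≤-Reasoning

  ⟦⟧-≤-scale : ∀ c x L (b : ℚ) → x ℕ.≤ c ℕ.* L → ⟦ L ⟧ ≤ℚ b → ⟦ x ⟧ ≤ℚ ⟦ c ⟧ · b
  ⟦⟧-≤-scale c x L b x≤cL L≤b = begin
      ⟦ x ⟧          ≤⟨ ⟦⟧-mono x≤cL ⟩
      ⟦ c ℕ.* L ⟧    ≡⟨ ⟦⟧-* c L ⟩
      ⟦ c ⟧ · ⟦ L ⟧  ≤⟨ *-monoˡ-≤-nonNeg ⟦ c ⟧ {{nonNegative (⟦⟧-nonNeg c)}} L≤b ⟩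
      ⟦ c ⟧ · b      ∎
    where open ≤-Reasoning

  -- Archimedean property: for β = (1+a)/(1+d) > 0, every n ≥ 1+d has β·n ≥ 1.
  archimedean : ∀ β → 0ℚ <ℚ β → Σ ℕ λ n₀ → ∀ n → n₀ ℕ.≤ n → ⟦ 1 ⟧ ≤ℚ β · ⟦ n ⟧
  archimedean β@(mkℚ +[1+ a ] d _) 0<β =
      suc d , λ n n₀≤n → ≤-trans atDenominator (*-monoˡ-≤-nonNeg β {{pos⇒nonNeg β {{positive 0<β}}}} (⟦⟧-mono n₀≤n))
    where
    1+d≤[1+a][1+d] : suc d ℕ.≤ suc a ℕ.* suc d
    1+d≤[1+a][1+d] = subst (suc d ℕ.≤_) (ℕP.*-comm (suc d) (suc a)) (ℕP.m≤m*n (suc d) (suc a))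
    inℚᵘ : toℚᵘ 1ℚ ℚᵘ.≤ (toℚᵘ β ℚᵘ.* toℚᵘ ⟦ suc d ⟧)
    inℚᵘ rewrite toℚᵘ-⟦⟧ (suc d) = ℚᵘ.*≤* (subst₂ ℤ._≤_ (sym (ℤP.*-identityˡ _)) (sym (ℤP.*-identityʳ _))
         (subst (+[1+ d ℕ.* 1 ] ℤ.≤_) (ℤP.pos-* (suc a) (suc d))
           (ℤ.+≤+ (subst (ℕ._≤ suc a ℕ.* suc d) (cong suc (sym (ℕP.*-identityʳ d))) 1+d≤[1+a][1+d]))))
    atDenominator : ⟦ 1 ⟧ ≤ℚ β · ⟦ suc d ⟧
    atDenominator = toℚᵘ-cancel-≤ (ℚᵘP.≤-respʳ-≃ (ℚᵘP.≃-sym (toℚᵘ-homo-* β ⟦ suc d ⟧)) inℚᵘ)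
  archimedean (mkℚ (+ zero)   d _) (*<* 0<0) = ⊥-elim (ℤP.<-irrefl refl 0<0)
  archimedean (mkℚ -[1+ a ]   d _) (*<* 0<β) =
    ⊥-elim (ℤP.<-asym (subst₂ ℤ._<_ (ℤP.*-zeroˡ +[1+ d ]) (ℤP.*-identityʳ -[1+ a ]) 0<β) ℤ.-<+)


-- The largest x ≤ k satisfying a decidable property P that holds at 0
-- (used for L = ⌊βn⌋, the largest x ≤ n with x ≤ βn).
module Largest {P : ℕ → Set} (P? : ∀ x → Dec (P x)) (P0 : P 0) where

  open import Data.Nat using (zero; suc; _≤_; z≤n; s≤s)
  open import Data.Nat.Properties using (m≤n⇒m<n∨m≡n; ≤-refl; m≤n⇒m≤1+n)
  open import Data.Sum using (inj₁; inj₂)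
  open import Relation.Binary.PropositionalEquality using (refl)
  open import Data.Empty using (⊥-elim)

  largest : ℕ → ℕ
  largest zero = zero
  largest (suc k) with P? (suc k)
  ... | yes _ = suc k
  ... | no  _ = largest k

  largest≤ : ∀ k → largest k ≤ k
  largest≤ zero = z≤n
  largest≤ (suc k) with P? (suc k)
  ... | yes _ = ≤-refl
  ... | no  _ = m≤n⇒m≤1+n (largest≤ k)

  largest-satisfies : ∀ k → P (largest k)
  largest-satisfies zero = P0
  largest-satisfies (suc k) with P? (suc k)
  ... | yes Pk = Pk
  ... | no  _  = largest-satisfies k

  largest-maximal : ∀ k x → x ≤ k → P x → x ≤ largest k
  largest-maximal zero    x x≤k _  = x≤k
  largest-maximal (suc k) x x≤k Px with P? (suc k)
  ... | yes _   = x≤k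
  ... | no  ¬Pk with m≤n⇒m<n∨m≡n x≤k
  ...   | inj₁ (s≤s x≤k′) = largest-maximal k x x≤k′ Px
  ...   | inj₂ refl       = ⊥-elim (¬Pk Px)

module Distances where

  open import Data.Nat
  open import Data.Nat.Properties
  open import Data.Sum using (inj₁; inj₂)
  open import Relation.Binary.PropositionalEquality
  open IntervalSums
  open import Data.Nat.Tactic.RingSolver using (solve-∀)

  ∣-∣≤-intro : ∀ {a b c} → a ≤ b + c → b ≤ a + c → ∣ a - b ∣ ≤ c
  ∣-∣≤-intro {a} {b} {c} a≤b+c b≤a+c with ≤-total a b
  ... | inj₁ a≤b = subst (_≤ c) (sym (m≤n⇒∣m-n∣≡n∸m a≤b)) (m≤n+o⇒m∸n≤o b a b≤a+c)
  ... | inj₂ b≤a = subst (_≤ c) (sym (m≤n⇒∣n-m∣≡n∸m b≤a)) (m≤n+o⇒m∸n≤o a b a≤b+c)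

  ∣-∣-+ : ∀ a b c d → ∣ a + b - c + d ∣ ≤ ∣ a - c ∣ + ∣ b - d ∣
  ∣-∣-+ a b c d = begin
      ∣ a + b - c + d ∣                      ≤⟨ ∣-∣-triangle (a + b) (a + d) (c + d) ⟩
      ∣ a + b - a + d ∣ + ∣ a + d - c + d ∣  ≡⟨ cong₂ _+_ (∣m+n-m+o∣≡∣n-o∣ a b d) (cong₂ ∣_-_∣ (+-comm a d) (+-comm c d)) ⟩
      ∣ b - d ∣ + ∣ d + a - d + c ∣          ≡⟨ cong (∣ b - d ∣ +_) (∣m+n-m+o∣≡∣n-o∣ d a c) ⟩
      ∣ b - d ∣ + ∣ a - c ∣                  ≡⟨ +-comm ∣ b - d ∣ ∣ a - c ∣ ⟩
      ∣ a - c ∣ + ∣ b - d ∣                  ∎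
    where open ≤-Reasoning

  ∣-∣-cancel : ∀ {x y s t c d} → ∣ x + s - y + t ∣ ≤ c → ∣ x - y ∣ ≤ d → ∣ s - t ∣ ≤ d + c
  ∣-∣-cancel {x} {y} {s} {t} {c} {d} close far = begin
      ∣ s - t ∣                          ≡⟨ sym (∣m+n-m+o∣≡∣n-o∣ (y + x) s t) ⟩
      ∣ y + x + s - y + x + t ∣          ≡⟨ cong₂ ∣_-_∣ (+-assoc y x s) (trans (cong (_+ t) (+-comm y x)) (+-assoc x y t)) ⟩
      ∣ y + (x + s) - x + (y + t) ∣      ≤⟨ ∣-∣-+ y (x + s) x (y + t) ⟩
      ∣ y - x ∣ + ∣ x + s - y + t ∣      ≤⟨ +-mono-≤ (subst (_≤ d) (∣-∣-comm x y) far) close ⟩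
      d + c                              ∎
    where open ≤-Reasoning

  ∣-∣-*ˡ : ∀ k {x y c} → ∣ x - y ∣ ≤ c → ∣ k * x - k * y ∣ ≤ k * c
  ∣-∣-*ˡ k {x} {y} ∣x-y∣≤c = subst (_≤ k * _) (*-distribˡ-∣-∣ k x y) (*-monoʳ-≤ k ∣x-y∣≤c)

  ∣-∣-sumFrom : ∀ f g c a k → (∀ p → ∣ f p - g p ∣ ≤ c) → ∣ sumFrom f a k - sumFrom g a k ∣ ≤ k * c
  ∣-∣-sumFrom f g c a zero    close = z≤n
  ∣-∣-sumFrom f g c a (suc k) close =
    ≤-trans (∣-∣-+ (f a) (sumFrom f (suc a) k) (g a) (sumFrom g (suc a) k))
            (+-mono-≤ (close a) (∣-∣-sumFrom f g c (suc a) k close))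

  ∣-∣-gaps : ∀ {x X y Y s S L} → x ≤ X → X < x + L → y ≤ Y → Y < y + L →
    x + s ≡ y → X + S ≡ Y → ∣ s - S ∣ ≤ L
  ∣-∣-gaps {x} {X} {y} {Y} {s} {S} {L} x≤X X<x+L y≤Y Y<y+L x+s≡y X+S≡Y = ∣-∣≤-intro (<⇒≤ s<S+L) (<⇒≤ S<s+L)
    where
    open ≤-Reasoning
    s<S+L : s < S + L
    s<S+L = +-cancelˡ-< x s (S + L) (begin-strict
        x + s          ≡⟨ x+s≡y ⟩
        y              ≤⟨ y≤Y ⟩
        Y              ≡⟨ sym X+S≡Y ⟩
        X + S          <⟨ +-monoˡ-< S X<x+L ⟩
        x + L + S      ≡⟨ trans (+-assoc x L S) (cong (x +_) (+-comm L S)) ⟩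
        x + (S + L)    ∎)
    S<s+L : S < s + L
    S<s+L = +-cancelˡ-< X S (s + L) (begin-strict
        X + S          ≡⟨ X+S≡Y ⟩
        Y              <⟨ Y<y+L ⟩
        y + L          ≡⟨ cong (_+ L) (sym x+s≡y) ⟩
        x + s + L      ≤⟨ +-monoˡ-≤ L (+-monoˡ-≤ s x≤X) ⟩
        X + s + L      ≡⟨ +-assoc X s L ⟩
        X + (s + L)    ∎)

  -- A column count s of one half of a row is
  -- 2L-close to the average r·s ≈ t of its half, the two halves t, t′ are
  -- L-close, the row has size t + t′ L-close to its target M, and M is
  -- 2r-close to 2r·m; altogether s is 4L-close to m.
  column-estimate : ∀ r L s m t t′ M → 1 ≤ r → 1 ≤ L →
    ∣ r * s - t ∣ ≤ r * (2 * L) → ∣ t - t′ ∣ ≤ L → ∣ t + t′ - M ∣ ≤ L → ∣ M - 2 * r * m ∣ ≤ 2 * r →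
    ∣ s - m ∣ ≤ 4 * L
  column-estimate r L s m t t′ M 1≤r 1≤L s≈avg t≈t′ size≈M M≈target =
    *-cancelˡ-≤ (2 * r) {{>-nonZero (≤-trans 1≤r (m≤m+n r (r + 0)))}} (begin
      2 * r * ∣ s - m ∣                                  ≡⟨ *-distribˡ-∣-∣ (2 * r) s m ⟩
      ∣ 2 * r * s - 2 * r * m ∣                          ≤⟨ ∣-∣-triangle (2 * r * s) (t + t) (2 * r * m) ⟩
      ∣ 2 * r * s - t + t ∣ + ∣ t + t - 2 * r * m ∣      ≤⟨ +-mono-≤ twice-avg (∣-∣-triangle (t + t) (t + t′) (2 * r * m)) ⟩
      2 * (r * (2 * L)) + (∣ t + t - t + t′ ∣ + ∣ t + t′ - 2 * r * m ∣)
        ≤⟨ +-monoʳ-≤ (2 * (r * (2 * L))) (+-mono-≤ (≤-reflexive (∣m+n-m+o∣≡∣n-o∣ t t t′)) (∣-∣-triangle (t + t′) M (2 * r * m))) ⟩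
      2 * (r * (2 * L)) + (∣ t - t′ ∣ + (∣ t + t′ - M ∣ + ∣ M - 2 * r * m ∣))
        ≤⟨ +-monoʳ-≤ (2 * (r * (2 * L))) (+-mono-≤ t≈t′ (+-mono-≤ size≈M M≈target)) ⟩
      2 * (r * (2 * L)) + (L + (L + 2 * r))              ≤⟨ +-monoʳ-≤ (2 * (r * (2 * L))) small ⟩
      2 * (r * (2 * L)) + 2 * (r * (2 * L))              ≡⟨ budget-identity r L ⟩
      2 * r * (4 * L)                                    ∎)
    where
    open ≤-Reasoning
    budget-identity : ∀ r L → 2 * (r * (2 * L)) + 2 * (r * (2 * L)) ≡ 2 * r * (4 * L)
    budget-identity = solve-∀
    small-identity : ∀ r L → r * L + (r * L + 2 * (r * L)) ≡ 2 * (r * (2 * L))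
    small-identity = solve-∀
    twice-avg : ∣ 2 * r * s - t + t ∣ ≤ 2 * (r * (2 * L))
    twice-avg = subst (_≤ 2 * (r * (2 * L))) (cong₂ ∣_-_∣ (sym (*-assoc 2 r s)) (cong (t +_) (+-identityʳ t)))
                  (∣-∣-*ˡ 2 {r * s} {t} s≈avg)
    small : L + (L + 2 * r) ≤ 2 * (r * (2 * L))
    small = begin
      L + (L + 2 * r)                   ≤⟨ +-mono-≤ (m≤n*m L r {{>-nonZero 1≤r}}) (+-mono-≤ (m≤n*m L r {{>-nonZero 1≤r}}) (*-monoʳ-≤ 2 (m≤m*n r L {{>-nonZero 1≤L}}))) ⟩
      r * L + (r * L + 2 * (r * L))     ≡⟨ small-identity r L ⟩
      2 * (r * (2 * L))                 ∎

module Blocks (L : ℕ) .{{_ : NonZero L}} where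

  open import Data.Nat
  open import Data.Nat.Properties
  open import Data.Nat.DivMod
  open import Data.Nat.Divisibility using (divides)
  open import Data.Sum using (_⊎_; inj₁; inj₂)
  open import Relation.Binary.PropositionalEquality
  open ≡-Reasoning

  block : ℕ → ℕ
  block p = p / L

  block-∈ : ∀ t p → t * L ≤ p → p < t * L + L → block p ≡ t
  block-∈ t p tL≤p p<tL+L = begin
      p / L                           ≡⟨ cong (_/ L) (sym (m∸n+n≡m tL≤p)) ⟩
      (p ∸ t * L + t * L) / L         ≡⟨ +-distrib-/-∣ʳ (p ∸ t * L) (divides t refl) ⟩
      (p ∸ t * L) / L + t * L / L     ≡⟨ cong₂ _+_ (m<n⇒m/n≡0 offset<L) (m*n/n≡m t L) ⟩
      t                               ∎
    where
    offset<L : p ∸ t * L < L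
    offset<L = subst (p ∸ t * L <_) (m+n∸m≡n (t * L) L) (∸-monoˡ-< p<tL+L tL≤p)

  block-close : ∀ u v → u ≤ v → v ≤ u + L → (block v ≡ block u) ⊎ (block v ≡ suc (block u))
  block-close u v u≤v v≤u+L with m≤n⇒m<n∨m≡n (/-monoˡ-≤ L u≤v)
  ... | inj₂ same = inj₁ (sym same)
  ... | inj₁ later = inj₂ (≤-antisym atMostNext later)
    where
    atMostNext : block v ≤ suc (block u)
    atMostNext = ≤-trans (/-monoˡ-≤ L v≤u+L) (≤-reflexive (begin
        (u + L) / L       ≡⟨ +-distrib-/-∣ʳ u (divides 1 (sym (+-identityʳ L))) ⟩
        u / L + L / L     ≡⟨ cong (u / L +_) (n/n≡1 L) ⟩
        u / L + 1         ≡⟨ +-comm (u / L) 1 ⟩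
        suc (u / L)       ∎))

-- Blocks are split by the parity of their index; the
-- part of a nonincreasing sequence lying on one parity class of an interval
-- exceeds the part on the other class by at most its first term.
module Alternation where

  open import Data.Nat hiding (_≟_)
  open import Data.Nat.Properties hiding (_≟_)
  open import Data.Bool using (Bool; true; false; not; _≟_)
  open import Relation.Nullary using (does)
  open import Data.Bool.Properties using (not-involutive)
  open import Data.Product using (_×_; _,_)
  open import Relation.Binary.PropositionalEquality
  open IntervalSums

  isOdd : ℕ → Bool
  isOdd zero    = false
  isOdd (suc t) = not (isOdd t)

  _==_ : Bool → Bool → Bool
  q == q′ = does (q ≟ q′)

  ==-refl : ∀ q → (q == q) ≡ true
  ==-refl true  = refl
  ==-refl false = refl

  ==-not : ∀ q → (q == not q) ≡ false
  ==-not true  = refl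
  ==-not false = refl

  ==-sound : ∀ q q′ → (q == q′) ≡ true → q ≡ q′
  ==-sound true  true  _ = refl
  ==-sound false false _ = refl
  ==-sound true  false ()
  ==-sound false true  ()

  paritySum : (ℕ → ℕ) → Bool → ℕ → ℕ → ℕ
  paritySum h q = sumFrom (λ t → keepIf (isOdd t == q) (h t))

  paritySum-split : ∀ h a k → paritySum h false a k + paritySum h true a k ≡ sumFrom h a k
  paritySum-split h a k = trans (sym (sumFrom-+ _ _ a k)) (sumFrom-cong a k (λ t _ _ → both (isOdd t) (h t)))
    where
    both : ∀ q x → keepIf (q == false) x + keepIf (q == true) x ≡ x
    both true  x = refl
    both false x = +-identityʳ x

  alternation : ∀ (h : ℕ → ℕ) → (∀ t → h (suc t) ≤ h t) → ∀ a k →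
    (paritySum h (not (isOdd a)) a k ≤ paritySum h (isOdd a) a k) ×
    (paritySum h (isOdd a) a k ≤ paritySum h (not (isOdd a)) a k + h a)
  alternation h decreasing a zero = z≤n , z≤n
  alternation h decreasing a (suc k) with alternation h decreasing (suc a) k
  ... | other≤this , this≤other+h rewrite ==-refl (isOdd a) | ==-not (isOdd a) | not-involutive (isOdd a) =
      ≤-trans this≤other+h (≤-trans (+-monoʳ-≤ _ (decreasing a)) (≤-reflexive (+-comm _ (h a))))
    , subst (h a + paritySum h (isOdd a) (suc a) k ≤_) (+-comm (h a) _) (+-monoʳ-≤ (h a) other≤this)

module Balance where

  open import Data.Nat
  open import Data.Nat.Properties
  open import Data.Fin using (Fin)
  open import Relation.Binary.PropositionalEquality
  open import Relation.Nullary using (yes; no)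

  Balanced : ∀ {r} → ℕ → (Fin r → ℕ) → Set
  Balanced L c = ∀ k k′ → c k ≤ c k′ + L

  balanced-step : ∀ {r L} (c f : Fin r → ℕ) → Balanced L c → (∀ k → f k ≤ L) →
    (∀ k k′ → c k′ < c k → f k ≤ f k′) → Balanced L (λ k → c k + f k)
  balanced-step {L = L} c f balanced f≤L antiSorted k k′ with c k′ <? c k
  ... | yes c′<c = ≤-trans (+-mono-≤ (balanced k k′) (antiSorted k k′ c′<c)) (≤-reflexive (+-comm-middle (c k′) L (f k′)))
    where
    +-comm-middle : ∀ x y z → x + y + z ≡ x + z + y
    +-comm-middle x y z = trans (+-assoc x y z) (trans (cong (x +_) (+-comm y z)) (sym (+-assoc x z y)))
  ... | no  c′≮c = ≤-trans (+-mono-≤ (≮⇒≥ c′≮c) (f≤L k)) (+-monoˡ-≤ L (m≤m+n (c k′) (f k′)))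

-- Vertices are the numbers p < n, cut into
-- blocks of length L; χ colours them with r colours.  Inside block t the
-- colours are renamed by a permutation σ t into r "slots", where σ t is
-- anti-sorted against the slot counts accumulated so far over the earlier
-- blocks of the same parity.  Hence (cumulative-balanced) at every time the
-- accumulated counts of any two slots differ by at most L.
module ColourBalancing (r′ n L′ : ℕ) (χ : ℕ → Fin (suc r′)) where

  open import Data.Nat hiding (_≟_)
  open import Data.Nat.Properties hiding (_≟_)
  open import Data.Bool using (Bool; true; false; _∧_)
  open import Data.Fin using (Fin)
  open import Data.Fin.Properties using (_≟_)
  open import Data.Fin.Permutation using (Permutation′; _⟨$⟩ʳ_; _⟨$⟩ˡ_; inverseˡ; inverseʳ) renaming (id to idPerm)
  open import Data.Product using (_×_; _,_; proj₁; proj₂)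
  open import Data.Sum using (inj₁; inj₂)
  open import Relation.Binary.PropositionalEquality
  open import Relation.Nullary using (does; ¬_)
  open import Relation.Nullary.Decidable using (does-⇔)
  open import Function.Bundles using (mk⇔)
  open IntervalSums
  open FinSums
  open AntiSort
  open Alternation
  open Balance

  r : ℕ
  r = suc r′

  L : ℕ
  L = suc L′

  open Blocks L public

  present : ℕ → Bool
  present p = p <ᵇ n

  colourCount : ℕ → Fin r → ℕ
  colourCount t c = countFrom (λ p → present p ∧ does (χ p ≟ c)) (t * L) L

  mutual
    σ : ℕ → Permutation′ r
    σ zero    = idPerm
    σ (suc t) = proj₁ (antiSort r (cumulative (isOdd (suc t)) (suc t)) (colourCount (suc t)))

    cumulative : Bool → ℕ → Fin r → ℕ
    cumulative q zero    k = 0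
    cumulative q (suc t) k = cumulative q t k + keepIf (isOdd t == q) (colourCount t (σ t ⟨$⟩ʳ k))

  slotCount : ℕ → Fin r → ℕ
  slotCount t k = colourCount t (σ t ⟨$⟩ʳ k)

  σ-antiSorted : ∀ t → AntiSorted (cumulative (isOdd t) t) (colourCount t) (σ t)
  σ-antiSorted zero    k k′ ()
  σ-antiSorted (suc t) = proj₂ (antiSort r (cumulative (isOdd (suc t)) (suc t)) (colourCount (suc t)))

  cumulative-balanced : ∀ q t → Balanced L (cumulative q t)
  cumulative-balanced q zero    k k′ = z≤n
  cumulative-balanced q (suc t) k k′ with isOdd t == q in same
  ... | false = subst₂ (λ x y → x ≤ y + L) (sym (+-identityʳ _)) (sym (+-identityʳ _)) (cumulative-balanced q t k k′)
  ... | true with ==-sound (isOdd t) q same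
  ...   | refl = balanced-step (cumulative (isOdd t) t) (slotCount t) (cumulative-balanced (isOdd t) t)
                   (λ k → countFrom≤ _ (t * L) L) (σ-antiSorted t) k k′

  cumulative-+ : ∀ q k a x → cumulative q a k + paritySum (λ t → slotCount t k) q a x ≡ cumulative q (a + x) k
  cumulative-+ q k a zero    = trans (+-identityʳ _) (cong (λ z → cumulative q z k) (sym (+-identityʳ a)))
  cumulative-+ q k a (suc x) = trans (sym (+-assoc (cumulative q a k) _ _))
    (trans (cumulative-+ q k (suc a) x) (cong (λ z → cumulative q z k) (sym (+-suc a x))))

  slot : ℕ → Fin r
  slot p = σ (block p) ⟨$⟩ˡ χ p

  slot-≟ : ∀ p k → does (slot p ≟ k) ≡ does (χ p ≟ (σ (block p) ⟨$⟩ʳ k))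
  slot-≟ p k = does-⇔ (mk⇔
    (λ eq → trans (sym (inverseʳ (σ (block p)))) (cong (σ (block p) ⟨$⟩ʳ_) eq))
    (λ eq → trans (cong (σ (block p) ⟨$⟩ˡ_) eq) (inverseˡ (σ (block p))))) (slot p ≟ k) (χ p ≟ (σ (block p) ⟨$⟩ʳ k))

  slotCount-slot : ∀ t k → slotCount t k ≡ countFrom (λ p → present p ∧ does (slot p ≟ k)) (t * L) L
  slotCount-slot t k = sumFrom-cong (t * L) L (λ p tL≤p p<end → cong (λ b → 𝟙 (present p ∧ b))
    (trans (cong (λ s → does (χ p ≟ (σ s ⟨$⟩ʳ k))) (sym (block-∈ t p tL≤p p<end))) (sym (slot-≟ p k))))

  inColumn : Bool → Fin r → ℕ → Bool
  inColumn q k p = present p ∧ ((isOdd (block p) == q) ∧ does (slot p ≟ k))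

  count-inColumn : ∀ q k t → countFrom (inColumn q k) (t * L) L ≡ keepIf (isOdd t == q) (slotCount t k)
  count-inColumn q k t = begin
      countFrom (inColumn q k) (t * L) L
        ≡⟨ sumFrom-cong (t * L) L (λ p tL≤p p<end → cong 𝟙 (reorder p (block-∈ t p tL≤p p<end))) ⟩
      countFrom (λ p → (isOdd t == q) ∧ (present p ∧ does (slot p ≟ k))) (t * L) L
        ≡⟨ countFrom-∧ (isOdd t == q) _ (t * L) L ⟩
      keepIf (isOdd t == q) (countFrom (λ p → present p ∧ does (slot p ≟ k)) (t * L) L)
        ≡⟨ cong (keepIf (isOdd t == q)) (sym (slotCount-slot t k)) ⟩
      keepIf (isOdd t == q) (slotCount t k) ∎
    where
    open ≡-Reasoning
    reorder : ∀ p → block p ≡ t → inColumn q k p ≡ (isOdd t == q) ∧ (present p ∧ does (slot p ≟ k))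
    reorder p refl with present p | isOdd (block p) == q
    ... | true  | true  = refl
    ... | true  | false = refl
    ... | false | true  = refl
    ... | false | false = refl

  blockSize : ℕ → ℕ
  blockSize t = countFrom present (t * L) L

  blockSize≤L : ∀ t → blockSize t ≤ L
  blockSize≤L t = countFrom≤ _ (t * L) L

  blockSize-nonincreasing : ∀ t → blockSize (suc t) ≤ blockSize t
  blockSize-nonincreasing t rewrite count-below n (suc t * L) L | count-below n (t * L) L =
    ⊓-monoʳ-≤ L (∸-monoʳ-≤ n (m≤n+m (t * L) L))

  slotCount-sum : ∀ t → sumFrom (λ k → slotCount t (clamp r′ k)) 0 r ≡ blockSize t
  slotCount-sum t = begin
      sumFrom (λ k → slotCount t (clamp r′ k)) 0 r
        ≡⟨ sumFrom-cong 0 r (λ k _ _ → slotCount-slot t (clamp r′ k)) ⟩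
      sumFrom (λ k → countFrom (λ p → present p ∧ does (slot p ≟ clamp r′ k)) (t * L) L) 0 r
        ≡⟨ sumFrom-swap (λ p k → 𝟙 (present p ∧ does (slot p ≟ clamp r′ k))) (t * L) L 0 r ⟩
      sumFrom (λ p → countFrom (λ k → present p ∧ does (slot p ≟ clamp r′ k)) 0 r) (t * L) L
        ≡⟨ sumFrom-cong (t * L) L (λ p _ _ → trans (countFrom-∧ (present p) _ 0 r) (onePerVertex (present p) (slot p))) ⟩
      blockSize t ∎
    where
    open ≡-Reasoning
    onePerVertex : ∀ b x → keepIf b (countFrom (λ k → does (x ≟ clamp r′ k)) 0 r) ≡ 𝟙 b
    onePerVertex true  x = one-hot r′ x
    onePerVertex false x = refl

  first-block : ∀ p → block p ≡ 0 → slot p ≡ χ p × isOdd (block p) ≡ false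
  first-block p eq rewrite eq = refl , refl

  -- Vertices at distance at most L with different colours get different
  -- (parity, slot) pairs: in one block σ is injective, and consecutive
  -- blocks have different parities.
  close-separated : ∀ u v → u ≤ v → v ≤ u + L → ¬ (χ u ≡ χ v) →
    ¬ (isOdd (block u) ≡ isOdd (block v) × slot u ≡ slot v)
  close-separated u v u≤v v≤u+L χu≢χv (sameParity , sameSlot) with block-close u v u≤v v≤u+L
  ... | inj₁ sameBlock = χu≢χv (begin
      χ u                                ≡⟨ sym (inverseʳ (σ (block u))) ⟩
      σ (block u) ⟨$⟩ʳ slot u             ≡⟨ cong (σ (block u) ⟨$⟩ʳ_) sameSlot ⟩
      σ (block u) ⟨$⟩ʳ slot v             ≡⟨ cong (λ s → σ s ⟨$⟩ʳ slot v) (sym sameBlock) ⟩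
      σ (block v) ⟨$⟩ʳ slot v             ≡⟨ inverseʳ (σ (block v)) ⟩
      χ v                                ∎)
    where open ≡-Reasoning
  ... | inj₂ nextBlock = not-¬ refl (trans sameParity (cong isOdd nextBlock))
    where open import Data.Bool.Properties using (not-¬)

-- Row i (i ≤ ℓ′) should receive M i vertices.  With the
-- prefix sums R i = M 0 + … + M (i-1), row i starts at block ⌊R i / L⌋, and
-- block t belongs to the last row starting at or before t.  Since every M i
-- is at least L, consecutive rows start at different blocks.
module RowSchedule (ℓ′ L′ : ℕ) (M : ℕ → ℕ) (L≤M : ∀ i → i ≤ ℓ′ → suc L′ ≤ M i) where

  open import Data.Nat
  open import Data.Nat.Properties
  open import Data.Nat.DivMod
  open import Data.Nat.Divisibility using (divides)
  open import Relation.Binary.PropositionalEquality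
  open import Data.Empty using (⊥-elim)
  open IntervalSums

  L : ℕ
  L = suc L′

  prefixMass : ℕ → ℕ
  prefixMass i = sumFrom M 0 i

  rowStart : ℕ → ℕ
  rowStart i = prefixMass i / L

  prefixMass-mono : ∀ {i j} → i ≤ j → prefixMass i ≤ prefixMass j
  prefixMass-mono {i} {j} i≤j = subst (λ z → prefixMass i ≤ prefixMass z) (m+[n∸m]≡n i≤j)
    (subst (prefixMass i ≤_) (sym (sumFrom-++ M 0 i (j ∸ i))) (m≤m+n _ _))

  rowStart-mono : ∀ {i j} → i ≤ j → rowStart i ≤ rowStart j
  rowStart-mono i≤j = /-monoˡ-≤ L (prefixMass-mono i≤j)

  rowStart-strict : ∀ i → i ≤ ℓ′ → rowStart i < rowStart (suc i)
  rowStart-strict i i≤ℓ′ = begin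
      suc (rowStart i)               ≡⟨ +-comm 1 (rowStart i) ⟩
      prefixMass i / L + 1           ≡⟨ cong (prefixMass i / L +_) (sym (n/n≡1 L)) ⟩
      prefixMass i / L + L / L       ≡⟨ sym (+-distrib-/-∣ʳ (prefixMass i) (divides 1 (sym (+-identityʳ L)))) ⟩
      (prefixMass i + L) / L         ≤⟨ /-monoˡ-≤ L (+-monoʳ-≤ (prefixMass i) (L≤M i i≤ℓ′)) ⟩
      (prefixMass i + M i) / L       ≡⟨ cong (_/ L) (sym (sumFrom-snoc M 0 i)) ⟩
      rowStart (suc i)               ∎
    where open ≤-Reasoning

  rowOf : ℕ → ℕ
  rowOf t = largest ℓ′
    where open Largest (λ i → rowStart i ≤? t) z≤n

  rowOf≤ℓ′ : ∀ t → rowOf t ≤ ℓ′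
  rowOf≤ℓ′ t = largest≤ ℓ′
    where open Largest (λ i → rowStart i ≤? t) z≤n

  rowOf-started : ∀ t i → i ≤ rowOf t → rowStart i ≤ t
  rowOf-started t i i≤row = ≤-trans (rowStart-mono i≤row) (largest-satisfies ℓ′)
    where open Largest (λ i → rowStart i ≤? t) z≤n

  rowOf-maximal : ∀ t i → i ≤ ℓ′ → rowStart i ≤ t → i ≤ rowOf t
  rowOf-maximal t i = largest-maximal ℓ′ i
    where open Largest (λ i → rowStart i ≤? t) z≤n

  rowOf-mono : ∀ {t t′} → t ≤ t′ → rowOf t ≤ rowOf t′
  rowOf-mono {t} t≤t′ = rowOf-maximal _ _ (rowOf≤ℓ′ t) (≤-trans (rowOf-started t (rowOf t) ≤-refl) t≤t′)

  rowOf-step : ∀ t → rowOf (suc t) ≤ suc (rowOf t)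
  rowOf-step t with rowOf (suc t) in eq
  ... | zero  = z≤n
  ... | suc w = s≤s (rowOf-maximal t w w≤ℓ′ (≤-pred (≤-trans (rowStart-strict w w≤ℓ′) started)))
    where
    w≤ℓ′ : w ≤ ℓ′
    w≤ℓ′ = ≤-trans (n≤1+n w) (subst (_≤ ℓ′) eq (rowOf≤ℓ′ (suc t)))
    started : rowStart (suc w) ≤ suc t
    started = rowOf-started (suc t) (suc w) (≤-reflexive (sym eq))

  rowOf-0 : rowOf 0 ≡ 0
  rowOf-0 with rowOf 0 in eq
  ... | zero  = refl
  ... | suc w = ⊥-elim (n≮0 (≤-trans (rowStart-strict w w≤ℓ′) (rowOf-started 0 (suc w) (≤-reflexive (sym eq)))))
    where
    w≤ℓ′ : w ≤ ℓ′
    w≤ℓ′ = ≤-trans (n≤1+n w) (subst (_≤ ℓ′) eq (rowOf≤ℓ′ 0))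

-- The construction, for r = suc r′ colours, ℓ = suc ℓ′ rows and n vertices
-- with βn ≥ 1.  Vertex v is identified with the number toℕ v < n; its block
-- decides its row, the parity of its block decides the half of the columns,
-- and its slot decides the column inside that half.
module Construction (r′ ℓ′ : ℕ) (β : ℚ) (0<β : 0ℚ <ℚ β) (n : ℕ) (1≤n : 1 ≤ n) (1≤βn : ⟦ 1 ⟧ ≤ℚ β · ⟦ n ⟧)
    (H : Graph n) (bandwidth : BandwidthAtMost H (β · ⟦ n ⟧))
    (m : Fin (suc ℓ′) → Fin (2 * suc r′) → ℕ)
    (m-total : ΣFin (suc ℓ′) (λ i → ΣFin (2 * suc r′) (λ j → m i j)) ≡ n)
    (m-large : ∀ i j → ⟦ 10 ⟧ · β · ⟦ n ⟧ ≤ℚ ⟦ m i j ⟧)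
    (m-even : ∀ i j j′ → ∣ m i j - m i j′ ∣ ≤ 1)
    (χ : Fin n → Fin (suc r′)) (χ-proper : ProperColouring H (suc r′) χ) where

  open import Data.Nat hiding (_≟_)
  open import Data.Nat.Properties hiding (_≟_)
  open import Data.Nat.DivMod using (_/_; _%_; m<n⇒m/n≡0; m/n*n≤m; m/n≤m; m≡m%n+[m/n]*n; m%n<n)
  open import Data.Nat using () renaming (_≟_ to _ℕ≟_)
  open import Data.Bool using (Bool; true; false; _∧_; not; T)
  open import Data.Bool.Properties using (T-≡; ∧-zeroʳ; ¬-not; not-involutive) renaming (_≟_ to _Bool≟_)
  open import Function using (_∘_; id; Equivalence; mk⇔)
  open import Data.Product.Properties using (≡-dec)
  open import Data.Fin using (zero; fromℕ<; _↑ˡ_; _↑ʳ_; splitAt)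
  open import Data.Fin.Properties using (toℕ-injective; toℕ<n; fromℕ<-toℕ; toℕ-inject≤; toℕ-↑ˡ; ↑ˡ-injective;
    splitAt-↑ˡ; splitAt-↑ʳ; join-splitAt; _≟_)
  open import Data.Fin.Subset using (_∈_)
  import Data.Vec as Vec
  import Data.Vec.Properties as VecP
  open import Data.Rational using (nonNegative)
  import Data.Rational.Properties as ℚP
  open import Data.Sum using (_⊎_; inj₁; inj₂)
  open import Relation.Binary.PropositionalEquality
  open import Relation.Nullary using (does; _×-dec_)
  open import Relation.Nullary.Decidable using (does-⇔; dec-false)
  open import Data.Empty using (⊥-elim)
  open IntervalSums
  open FinSums
  open NatInRationals
  open Alternation
  open Distances

  ℓ : ℕ
  ℓ = suc ℓ′

  βn : ℚ
  βn = β · ⟦ n ⟧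

  -- The block length L = ⌊βn⌋, the largest L ≤ n with L ≤ βn; it is ≥ 1.
  -- (It is kept opaque: only L≤βn and ≤L below are ever needed about it.)
  module BlockLength = Largest (λ x → ⟦ x ⟧ ℚP.≤? βn) (*⟦⟧-nonNeg β n 0<β)

  opaque
    L′ : ℕ
    L′ = pred (BlockLength.largest n)

    suc-L′ : suc L′ ≡ BlockLength.largest n
    suc-L′ = suc-pred (BlockLength.largest n) {{>-nonZero (BlockLength.largest-maximal n 1 1≤n 1≤βn)}}

  L≤βn : ⟦ suc L′ ⟧ ≤ℚ βn
  L≤βn = subst (λ z → ⟦ z ⟧ ≤ℚ βn) (sym suc-L′) (BlockLength.largest-satisfies n)

  ≤L : ∀ x → x ≤ n → ⟦ x ⟧ ≤ℚ βn → x ≤ suc L′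
  ≤L x x≤n x≤βn = subst (x ≤_) (sym suc-L′) (BlockLength.largest-maximal n x x≤n x≤βn)

  βn≤10βn : βn ≤ℚ ⟦ 10 ⟧ · β · ⟦ n ⟧
  βn≤10βn = subst (βn ≤ℚ_) (sym (ℚP.*-assoc ⟦ 10 ⟧ β ⟦ n ⟧)) (begin
      βn                ≡⟨ sym (ℚP.*-identityˡ βn) ⟩
      1ℚ · βn           ≤⟨ ℚP.*-monoʳ-≤-nonNeg βn {{nonNegative (*⟦⟧-nonNeg β n 0<β)}} (⟦⟧-mono {1} {10} (s≤s z≤n)) ⟩
      ⟦ 10 ⟧ · βn       ∎)
    where open ℚP.≤-Reasoning

  opaque
    χℕ : ℕ → Fin (suc r′)
    χℕ p with p <? n
    ... | yes p<n = χ (fromℕ< p<n)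
    ... | no  _   = zero

    χℕ-toℕ : ∀ v → χℕ (toℕ v) ≡ χ v
    χℕ-toℕ v with toℕ v <? n
    ... | yes v<n = cong χ (fromℕ<-toℕ v v<n)
    ... | no  v≮n = ⊥-elim (v≮n (toℕ<n v))

  rowMass : ℕ → ℕ
  rowMass i = ΣFin (2 * suc r′) (m (clamp ℓ′ i))

  L≤m : ∀ i j → suc L′ ≤ m i j
  L≤m i j = ⟦⟧-cancel (ℚP.≤-trans L≤βn (ℚP.≤-trans βn≤10βn (m-large i j)))

  L≤rowMass : ∀ i → i ≤ ℓ′ → suc L′ ≤ rowMass i
  L≤rowMass i _ = ≤-trans (L≤m (clamp ℓ′ i) zero) (m≤m+n _ _)

  open ColourBalancing r′ n L′ χℕ
  open RowSchedule ℓ′ L′ rowMass L≤rowMass hiding (L)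

  prefixMass-ℓ : prefixMass ℓ ≡ n
  prefixMass-ℓ = trans (sym (sumFin-clamp ℓ′ (λ i → ΣFin (2 * r) (m i)))) m-total

  column : Bool → Fin r → Fin (2 * r)
  column false k = k ↑ˡ (r + 0)
  column true  k = r ↑ʳ (k ↑ˡ 0)

  column-injective : ∀ {q q′ k k′} → column q k ≡ column q′ k′ → q ≡ q′ × k ≡ k′
  column-injective {false} {false} {k} {k′} eq = refl , ↑ˡ-injective (r + 0) k k′ eq
  column-injective {true}  {true}  {k} {k′} eq = refl , ↑ˡ-injective 0 k k′
      (halves (trans (sym (splitAt-↑ʳ r (r + 0) (k ↑ˡ 0))) (trans (cong (splitAt r) eq) (splitAt-↑ʳ r (r + 0) (k′ ↑ˡ 0)))))
    where
    halves : ∀ {x y : Fin (r + 0)} → inj₂ {A = Fin r} x ≡ inj₂ y → x ≡ y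
    halves refl = refl
  column-injective {false} {true}  {k} {k′} eq with trans (sym (splitAt-↑ˡ r k (r + 0))) (trans (cong (splitAt r) eq) (splitAt-↑ʳ r (r + 0) (k′ ↑ˡ 0)))
  ... | ()
  column-injective {true}  {false} {k} {k′} eq with trans (sym (splitAt-↑ʳ r (r + 0) (k ↑ˡ 0))) (trans (cong (splitAt r) eq) (splitAt-↑ˡ r k′ (r + 0)))
  ... | ()

  column-surjective : ∀ j → Σ Bool λ q → Σ (Fin r) λ k → column q k ≡ j
  column-surjective j with splitAt r j | join-splitAt r (r + 0) j
  ... | inj₁ k  | first = false , k , first
  ... | inj₂ j′ | second with splitAt r j′ | join-splitAt r 0 j′
  ...   | inj₁ k  | inFirst = true , k , trans (cong (r ↑ʳ_) inFirst) second

  column-embCol : ∀ c → column false c ≡ embCol c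
  column-embCol c = toℕ-injective (trans (toℕ-↑ˡ c (r + 0)) (sym (toℕ-inject≤ c _)))

  rowℕ : ℕ → ℕ
  rowℕ p = rowOf (block p)

  f : Fin n → Fin ℓ × Fin (2 * r)
  f v = clamp ℓ′ (rowℕ (toℕ v)) , column (isOdd (block (toℕ v))) (slot (toℕ v))

  toℕ-row : ∀ v → toℕ (proj₁ (f v)) ≡ rowℕ (toℕ v)
  toℕ-row v = toℕ-clamp ℓ′ _ (rowOf≤ℓ′ _)

  opensRow : ℕ → Bool
  opensRow t = not (rowOf t ≡ᵇ rowOf (pred t))

  B : Subset n
  B = Vec.tabulate (λ v → opensRow (block (toℕ v)))

  ∈B : ∀ v → v ∈ B → opensRow (block (toℕ v)) ≡ true
  ∈B v v∈B = trans (sym (VecP.lookup∘tabulate _ v)) (VecP.[]=⇒lookup v∈B)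

  ∉B : ∀ v → v ∉ B → opensRow (block (toℕ v)) ≡ false
  ∉B v v∉B with opensRow (block (toℕ v)) in opens
  ... | true  = ⊥-elim (v∉B (VecP.lookup⇒[]= v B (trans (VecP.lookup∘tabulate _ v) opens)))
  ... | false = refl

  false≢true : ¬ (false ≡ true)
  false≢true ()

  opensRow-0 : opensRow 0 ≡ false
  opensRow-0 = cong (λ x → not (x ≡ᵇ x)) rowOf-0

  initial-block : ∀ (s : Fin n) → ⟦ toℕ s + 1 ⟧ ≤ℚ βn → block (toℕ s) ≡ 0
  initial-block s s+1≤βn = m<n⇒m/n≡0 (subst (_≤ L) (+-comm (toℕ s) 1)
    (≤L (toℕ s + 1) (subst (_≤ n) (+-comm 1 (toℕ s)) (toℕ<n s)) s+1≤βn))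

  initial-∉B : ∀ (s : Fin n) → ⟦ toℕ s + 1 ⟧ ≤ℚ βn → s ∉ B
  initial-∉B s s+1≤βn s∈B = false≢true (trans (sym opensRow-s) (∈B s s∈B))
    where
    opensRow-s : opensRow (block (toℕ s)) ≡ false
    opensRow-s = trans (cong opensRow (initial-block s s+1≤βn)) opensRow-0

  initial-f : ∀ (s : Fin n) → ⟦ toℕ s + 1 ⟧ ≤ℚ βn → (toℕ (proj₁ (f s)) ≡ 0) × (proj₂ (f s) ≡ embCol (χ s))
  initial-f s s+1≤βn = trans (toℕ-row s) (trans (cong rowOf inBlock0) rowOf-0)
                     , subst (λ t → column (isOdd t) (slot (toℕ s)) ≡ embCol (χ s)) (sym inBlock0)
                         (trans (cong (column false) (trans (proj₁ (first-block (toℕ s) inBlock0)) (χℕ-toℕ s))) (column-embCol (χ s)))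
    where
    inBlock0 : block (toℕ s) ≡ 0
    inBlock0 = initial-block s s+1≤βn

  rows-close : ∀ p p′ → p ≤ p′ → p′ ≤ p + L →
    (∣ rowℕ p - rowℕ p′ ∣ ≤ 1) × (opensRow (block p′) ≡ false → rowℕ p ≡ rowℕ p′)
  rows-close p p′ p≤p′ p′≤p+L with block-close p p′ p≤p′ p′≤p+L
  ... | inj₁ sameBlock = ≤-trans (≤-reflexive (m≡n⇒∣m-n∣≡0 (cong rowOf (sym sameBlock)))) z≤n
                       , λ _ → cong rowOf (sym sameBlock)
  ... | inj₂ nextBlock = ∣-∣≤-intro (≤-trans lower (m≤m+n _ 1)) (subst (rowℕ p′ ≤_) (+-comm 1 (rowℕ p)) upper)
                       , sameUnlessOpens
    where
    lower : rowℕ p ≤ rowℕ p′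
    lower = subst (λ t → rowℕ p ≤ rowOf t) (sym nextBlock) (rowOf-mono (n≤1+n (block p)))
    upper : rowℕ p′ ≤ suc (rowℕ p)
    upper = subst (λ t → rowOf t ≤ suc (rowℕ p)) (sym nextBlock) (rowOf-step (block p))
    not-false : ∀ x → not x ≡ false → T x
    not-false true _ = _
    sameUnlessOpens : opensRow (block p′) ≡ false → rowℕ p ≡ rowℕ p′
    sameUnlessOpens closed = sym (trans (≡ᵇ⇒≡ _ _ (not-false _ closed)) (cong (λ t → rowOf (pred t)) nextBlock))

  EdgeOK : Fin n → Fin n → Set
  EdgeOK u v = (∣ toℕ (proj₁ (f u)) - toℕ (proj₁ (f v)) ∣ ≤ 1)
             × ¬ (proj₂ (f u) ≡ proj₂ (f v))
             × (u ∉ B → v ∉ B → proj₁ (f u) ≡ proj₁ (f v))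

  EdgeOK-sym : ∀ u v → EdgeOK u v → EdgeOK v u
  EdgeOK-sym u v (rowsOK , columnsOK , sameRow) =
    subst (_≤ 1) (∣-∣-comm (toℕ (proj₁ (f u))) (toℕ (proj₁ (f v)))) rowsOK , (λ eq → columnsOK (sym eq)) , (λ v∉B u∉B → sym (sameRow u∉B v∉B))

  edge-forward : ∀ u v → Edge H u v → toℕ u ≤ toℕ v → EdgeOK u v
  edge-forward u v uv u≤v = rowsOK , columnsOK , sameRow
    where
    near : toℕ v ≤ toℕ u + L
    near = ≤-trans (m≤n+∣m-n∣ (toℕ v) (toℕ u)) (+-monoʳ-≤ (toℕ u) (subst (_≤ L) (∣-∣-comm (toℕ u) (toℕ v))
             (≤L _ (≤-trans (∣m-n∣≤m⊔n (toℕ u) (toℕ v)) (⊔-lub (<⇒≤ (toℕ<n u)) (<⇒≤ (toℕ<n v)))) (bandwidth u v uv))))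
    rows : (∣ rowℕ (toℕ u) - rowℕ (toℕ v) ∣ ≤ 1) × (opensRow (block (toℕ v)) ≡ false → rowℕ (toℕ u) ≡ rowℕ (toℕ v))
    rows = rows-close (toℕ u) (toℕ v) u≤v near
    rowsOK : ∣ toℕ (proj₁ (f u)) - toℕ (proj₁ (f v)) ∣ ≤ 1
    rowsOK = subst₂ (λ x y → ∣ x - y ∣ ≤ 1) (sym (toℕ-row u)) (sym (toℕ-row v)) (proj₁ rows)
    differentColours : ¬ (χℕ (toℕ u) ≡ χℕ (toℕ v))
    differentColours eq = χ-proper u v uv (trans (sym (χℕ-toℕ u)) (trans eq (χℕ-toℕ v)))
    columnsOK : ¬ (proj₂ (f u) ≡ proj₂ (f v))
    columnsOK eq = close-separated (toℕ u) (toℕ v) u≤v near differentColours (column-injective eq)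
    sameRow : u ∉ B → v ∉ B → proj₁ (f u) ≡ proj₁ (f v)
    sameRow _ v∉B = cong (clamp ℓ′) (proj₂ rows (∉B v v∉B))

  edgeOK : ∀ u v → Edge H u v → EdgeOK u v
  edgeOK u v uv with ≤-total (toℕ u) (toℕ v)
  ... | inj₁ u≤v = edge-forward u v uv u≤v
  ... | inj₂ v≤u = EdgeOK-sym v u (edge-forward v u (subst T (Defs.sym H u v) uv) v≤u)

  -- Each opening of a row advances the row index.
  openings≤row : ∀ N → countFrom opensRow 0 (suc N) ≤ rowOf N
  openings≤row zero    = subst (λ b → 𝟙 b + 0 ≤ rowOf 0) (sym opensRow-0) z≤n
  openings≤row (suc N) = begin
      countFrom opensRow 0 (suc (suc N))                    ≡⟨ sumFrom-snoc (𝟙 ∘ opensRow) 0 (suc N) ⟩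
      countFrom opensRow 0 (suc N) + 𝟙 (opensRow (suc N))   ≤⟨ +-monoˡ-≤ (𝟙 (opensRow (suc N))) (openings≤row N) ⟩
      rowOf N + 𝟙 (opensRow (suc N))                         ≤⟨ advance (rowOf N) (rowOf (suc N)) (rowOf-mono (n≤1+n N)) ⟩
      rowOf (suc N)                                         ∎
    where
    open ≤-Reasoning
    advance : ∀ x y → x ≤ y → x + 𝟙 (not (y ≡ᵇ x)) ≤ y
    advance x y x≤y with m≤n⇒m<n∨m≡n x≤y
    ... | inj₁ x<y  = ≤-trans (+-monoʳ-≤ x (𝟙≤1 _)) (subst (_≤ y) (+-comm 1 x) x<y)
    ... | inj₂ refl = subst (λ b → x + 𝟙 (not b) ≤ x) (sym (Equivalence.to T-≡ (≡⇒≡ᵇ x x refl))) (≤-reflexive (+-identityʳ x))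

  -- B is covered by at most ℓ′ blocks.
  ∣B∣≤Lℓ′ : ∣ B ∣ ≤ L * ℓ′
  ∣B∣≤Lℓ′ = begin
      ∣ B ∣                                                      ≡⟨ count-tabulate n _ (opensRow ∘ block) 0 (λ _ → refl) ⟩
      countFrom (opensRow ∘ block) 0 n                           ≤⟨ sumFrom-prefix _ 0 (m≤m*n n L) ⟩
      countFrom (opensRow ∘ block) 0 (n * L)                     ≡⟨ sumFrom-blocks L _ 0 n ⟩
      sumFrom (λ t → countFrom (opensRow ∘ block) (t * L) L) 0 n ≡⟨ sumFrom-cong 0 n (λ t _ _ → blockwise t) ⟩
      sumFrom (λ t → L * 𝟙 (opensRow t)) 0 n                     ≡⟨ sumFrom-*ˡ L (𝟙 ∘ opensRow) 0 n ⟩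
      L * countFrom opensRow 0 n                                 ≤⟨ *-monoʳ-≤ L openings ⟩
      L * ℓ′                                                     ∎
    where
    open ≤-Reasoning
    blockwise : ∀ t → countFrom (opensRow ∘ block) (t * L) L ≡ L * 𝟙 (opensRow t)
    blockwise t = trans (sumFrom-cong (t * L) L (λ p tL≤p p<end → cong (𝟙 ∘ opensRow) (block-∈ t p tL≤p p<end)))
                        (sumFrom-const (𝟙 (opensRow t)) (t * L) L)
    openings : countFrom opensRow 0 n ≤ ℓ′
    openings = subst (λ N → countFrom opensRow 0 N ≤ ℓ′) (suc-pred n {{>-nonZero 1≤n}})
                 (≤-trans (openings≤row (pred n)) (rowOf≤ℓ′ _))

  ∣B∣≤2ℓβn : ⟦ ∣ B ∣ ⟧ ≤ℚ ⟦ 2 ⟧ · ⟦ ℓ ⟧ · β · ⟦ n ⟧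
  ∣B∣≤2ℓβn = subst (⟦ ∣ B ∣ ⟧ ≤ℚ_) scaled (⟦⟧-≤-scale (2 * ℓ) ∣ B ∣ L βn (≤-trans ∣B∣≤Lℓ′ Lℓ′≤2ℓL) L≤βn)
    where
    Lℓ′≤2ℓL : L * ℓ′ ≤ 2 * ℓ * L
    Lℓ′≤2ℓL = subst (L * ℓ′ ≤_) (*-comm L (2 * ℓ)) (*-monoʳ-≤ L (≤-trans (n≤1+n ℓ′) (m≤m+n ℓ (ℓ + 0))))
    scaled : ⟦ 2 * ℓ ⟧ · βn ≡ ⟦ 2 ⟧ · ⟦ ℓ ⟧ · β · ⟦ n ⟧
    scaled = trans (cong (_· βn) (⟦⟧-* 2 ℓ)) (sym (ℚP.*-assoc (⟦ 2 ⟧ · ⟦ ℓ ⟧) β ⟦ n ⟧))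

  floor≤ : ∀ x → x / L * L ≤ x
  floor≤ x = m/n*n≤m x L

  <floor+L : ∀ x → x < x / L * L + L
  <floor+L x = subst (_< x / L * L + L) (sym (trans (m≡m%n+[m/n]*n x L) (+-comm (x % L) _))) (+-monoʳ-< (x / L * L) (m%n<n x L))

  prefixMass≤n : ∀ i → i ≤ ℓ → prefixMass i ≤ n
  prefixMass≤n i i≤ℓ = subst (prefixMass i ≤_) prefixMass-ℓ (prefixMass-mono i≤ℓ)

  -- Row i occupies the blocks [rowStart i, E): E is the start of the next row,
  -- or n (beyond every vertex) for the last row.
  RowEnd : ℕ → ℕ → Set
  RowEnd i E = (i < ℓ′ × E ≡ rowStart (suc i)) ⊎ (i ≡ ℓ′ × E ≡ n)

  rowEnd : ∀ i → i ≤ ℓ′ → Σ ℕ (RowEnd i)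
  rowEnd i i≤ℓ′ with m≤n⇒m<n∨m≡n i≤ℓ′
  ... | inj₁ i<ℓ′ = rowStart (suc i) , inj₁ (i<ℓ′ , refl)
  ... | inj₂ i≡ℓ′ = n , inj₂ (i≡ℓ′ , refl)

  cell? : ∀ i q k p → Dec (rowℕ p ≡ i × p < n × isOdd (block p) ≡ q × slot p ≡ k)
  cell? i q k p = (rowℕ p ℕ≟ i) ×-dec ((p <? n) ×-dec ((isOdd (block p) Bool≟ q) ×-dec (slot p ≟ k)))

  preimage-cell : ∀ (i : Fin ℓ) q k → preimageSize f (i , column q k) ≡ countFrom (λ p → does (cell? (toℕ i) q k p)) 0 n
  preimage-cell i q k = length-filter-tabulate (λ v → ≡-dec _≟_ _≟_ (f v) (i , column q k)) n id (λ p → does (cell? (toℕ i) q k p)) 0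
    (λ v → does-⇔ (mk⇔ (to v) (from v)) (≡-dec _≟_ _≟_ (f v) (i , column q k)) (cell? (toℕ i) q k (toℕ v)))
    where
    to : ∀ v → f v ≡ (i , column q k) → rowℕ (toℕ v) ≡ toℕ i × toℕ v < n × isOdd (block (toℕ v)) ≡ q × slot (toℕ v) ≡ k
    to v eq = trans (sym (toℕ-row v)) (cong (toℕ ∘ proj₁) eq) , toℕ<n v , column-injective (cong proj₂ eq)
    from : ∀ v → rowℕ (toℕ v) ≡ toℕ i × toℕ v < n × isOdd (block (toℕ v)) ≡ q × slot (toℕ v) ≡ k → f v ≡ (i , column q k)
    from v (sameRow , _ , sameHalf , sameSlot) =
      cong₂ _,_ (trans (cong (clamp ℓ′) sameRow) (clamp-toℕ ℓ′ i)) (cong₂ column sameHalf sameSlot)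

  -- The m i j′ differ by at most one, so the mass of row i is 2r-close to 2r · m i j.
  rowMass-close : ∀ (i : Fin ℓ) j → ∣ rowMass (toℕ i) - 2 * r * m i j ∣ ≤ 2 * r
  rowMass-close i j = subst₂ (λ x y → ∣ x - y ∣ ≤ 2 * r) (sym asSum) (sumFrom-const (m i j) 0 (2 * r))
    (subst (∣ sumFrom (m i ∘ clamp c) 0 (2 * r) - sumFrom (λ _ → m i j) 0 (2 * r) ∣ ≤_) (*-identityʳ (2 * r))
      (∣-∣-sumFrom (m i ∘ clamp c) (λ _ → m i j) 1 0 (2 * r) (λ k → m-even i (clamp c k) j)))
    where
    c : ℕ     -- 2r = suc c
    c = r′ + (r + 0)
    asSum : rowMass (toℕ i) ≡ sumFrom (m i ∘ clamp c) 0 (2 * r)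
    asSum = trans (cong (λ i′ → ΣFin (2 * r) (m i′)) (clamp-toℕ ℓ′ i)) (sumFin-clamp c (m i))

  module Row (i : ℕ) (i≤ℓ′ : i ≤ ℓ′) (E : ℕ) (end : RowEnd i E) where

    a : ℕ
    a = rowStart i

    span : ℕ
    span = E ∸ a

    a≤E : a ≤ E
    a≤E = atEnd end
      where
      atEnd : RowEnd i E → a ≤ E
      atEnd (inj₁ (_ , E≡)) = subst (a ≤_) (sym E≡) (rowStart-mono (n≤1+n i))
      atEnd (inj₂ (_ , E≡)) = subst (a ≤_) (sym E≡) (≤-trans (m/n≤m (prefixMass i) L) (prefixMass≤n i (≤-trans i≤ℓ′ (n≤1+n ℓ′))))

    E≤n : E ≤ n
    E≤n = atEnd end
      where
      atEnd : RowEnd i E → E ≤ n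
      atEnd (inj₁ (i<ℓ′ , E≡)) = subst (_≤ n) (sym E≡) (≤-trans (m/n≤m (prefixMass (suc i)) L) (prefixMass≤n (suc i) (s≤s (<⇒≤ i<ℓ′))))
      atEnd (inj₂ (_    , E≡)) = ≤-reflexive E≡

    inRow⇒ : ∀ t → t < n → rowOf t ≡ i → a ≤ t × t < E
    inRow⇒ t t<n rowt≡i = rowOf-started t i (≤-reflexive (sym rowt≡i)) , beforeEnd end
      where
      beforeEnd : RowEnd i E → t < E
      beforeEnd (inj₁ (i<ℓ′ , E≡)) = subst (t <_) (sym E≡)
        (≰⇒> (λ started → 1+n≰n (subst (suc i ≤_) rowt≡i (rowOf-maximal t (suc i) i<ℓ′ started))))
      beforeEnd (inj₂ (_    , E≡)) = subst (t <_) (sym E≡) t<n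

    inRow⇐ : ∀ t → a ≤ t → t < E → rowOf t ≡ i
    inRow⇐ t a≤t t<E = ≤-antisym (notLater end) (rowOf-maximal t i i≤ℓ′ a≤t)
      where
      notLater : RowEnd i E → rowOf t ≤ i
      notLater (inj₁ (_ , E≡))    = ≮⇒≥ (λ i<rowt → <⇒≱ (subst (t <_) E≡ t<E) (rowOf-started t (suc i) i<rowt))
      notLater (inj₂ (i≡ℓ′ , _))  = subst (rowOf t ≤_) (sym i≡ℓ′) (rowOf≤ℓ′ t)

    columnCount : Bool → Fin r → ℕ
    columnCount q k = paritySum (λ t → slotCount t k) q a span

    cellCount : ∀ q k → countFrom (λ p → does (cell? i q k p)) 0 n ≡ columnCount q k
    cellCount q k = begin
        countFrom P 0 n                                 ≡⟨ sym (sumFrom-zero-tail (𝟙 ∘ P) 0 (m≤m*n n L) beyond) ⟩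
        countFrom P 0 (n * L)                           ≡⟨ sumFrom-blocks L (𝟙 ∘ P) 0 n ⟩
        sumFrom (λ t → countFrom P (t * L) L) 0 n       ≡⟨ sumFrom-cong 0 n (λ t _ _ → inBlock t) ⟩
        sumFrom (λ t → keepIf (rowOf t ≡ᵇ i) (keepIf (isOdd t == q) (slotCount t k))) 0 n
          ≡⟨ sumFrom-select (λ t → rowOf t ≡ᵇ i) _ a E n a≤E E≤n
               (λ t t<n inRow → inRow⇒ t t<n (≡ᵇ⇒≡ _ _ (Equivalence.from T-≡ inRow)))
               (λ t a≤t t<E → Equivalence.to T-≡ (≡⇒≡ᵇ _ _ (inRow⇐ t a≤t t<E))) ⟩
        columnCount q k                                 ∎
      where
      open ≡-Reasoning
      P : ℕ → Bool
      P p = does (cell? i q k p)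
      beyond : ∀ p → n ≤ p → 𝟙 (P p) ≡ 0
      beyond p n≤p = cong 𝟙 (trans (cong (λ b → (rowℕ p ≡ᵇ i) ∧ (b ∧ ((isOdd (block p) == q) ∧ does (slot p ≟ k)))) absent) (∧-zeroʳ (rowℕ p ≡ᵇ i)))
        where
        absent : (p <ᵇ n) ≡ false
        absent = dec-false (p <? n) (λ p<n → <⇒≱ p<n n≤p)
      inBlock : ∀ t → countFrom P (t * L) L ≡ keepIf (rowOf t ≡ᵇ i) (keepIf (isOdd t == q) (slotCount t k))
      inBlock t = begin
          countFrom P (t * L) L
            ≡⟨ sumFrom-cong (t * L) L (λ p tL≤p p<end → cong (λ s → 𝟙 ((rowOf s ≡ᵇ i) ∧ inColumn q k p)) (block-∈ t p tL≤p p<end)) ⟩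
          countFrom (λ p → (rowOf t ≡ᵇ i) ∧ inColumn q k p) (t * L) L
            ≡⟨ countFrom-∧ (rowOf t ≡ᵇ i) (inColumn q k) (t * L) L ⟩
          keepIf (rowOf t ≡ᵇ i) (countFrom (inColumn q k) (t * L) L)
            ≡⟨ cong (keepIf (rowOf t ≡ᵇ i)) (count-inColumn q k t) ⟩
          keepIf (rowOf t ≡ᵇ i) (keepIf (isOdd t == q) (slotCount t k)) ∎

    -- Any two columns of one half of the row are 2L-close: the accumulated
    -- counts are L-balanced both where the row starts and where it ends.
    columnCount-close : ∀ q k k′ → ∣ columnCount q k - columnCount q k′ ∣ ≤ 2 * L
    columnCount-close q k k′ = subst (∣ columnCount q k - columnCount q k′ ∣ ≤_) (cong (L +_) (sym (+-identityʳ L)))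
      (∣-∣-cancel {x = cumulative q a k} {y = cumulative q a k′}
        (subst₂ (λ x y → ∣ x - y ∣ ≤ L) (sym (cumulative-+ q k a span)) (sym (cumulative-+ q k′ a span)) (balanced (a + span)))
        (balanced a))
      where
      balanced : ∀ t → ∣ cumulative q t k - cumulative q t k′ ∣ ≤ L
      balanced t = ∣-∣≤-intro (cumulative-balanced q t k k′) (cumulative-balanced q t k′ k)

    halfSize : Bool → ℕ
    halfSize q = paritySum blockSize q a span

    columnCount-sum : ∀ q → sumFrom (λ k → columnCount q (clamp r′ k)) 0 r ≡ halfSize q
    columnCount-sum q = begin
        sumFrom (λ k → paritySum (λ t → slotCount t (clamp r′ k)) q a span) 0 r
          ≡⟨ sumFrom-swap (λ t k → keepIf (isOdd t == q) (slotCount t (clamp r′ k))) a span 0 r ⟩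
        sumFrom (λ t → sumFrom (λ k → keepIf (isOdd t == q) (slotCount t (clamp r′ k))) 0 r) a span
          ≡⟨ sumFrom-cong a span (λ t _ _ → trans (sumFrom-keepIf (isOdd t == q) _ 0 r) (cong (keepIf (isOdd t == q)) (slotCount-sum t))) ⟩
        halfSize q ∎
      where open ≡-Reasoning

    -- Consecutive blocks alternate parity and shrink, so the halves are L-close.
    startHalf-close : ∣ halfSize (isOdd a) - halfSize (not (isOdd a)) ∣ ≤ L
    startHalf-close = ∣-∣≤-intro (≤-trans (proj₂ alt) (+-monoʳ-≤ _ (blockSize≤L a))) (≤-trans (proj₁ alt) (m≤m+n _ L))
      where
      alt : (halfSize (not (isOdd a)) ≤ halfSize (isOdd a)) × (halfSize (isOdd a) ≤ halfSize (not (isOdd a)) + blockSize a)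
      alt = alternation blockSize blockSize-nonincreasing a span

    halves-close : ∀ q → ∣ halfSize q - halfSize (not q) ∣ ≤ L
    halves-close q with q Bool≟ isOdd a
    ... | yes refl = startHalf-close
    ... | no  q≢p  rewrite ¬-not q≢p | not-involutive (isOdd a) = subst (_≤ L) (∣-∣-comm (halfSize (isOdd a)) (halfSize (not (isOdd a)))) startHalf-close

    rowSize : ℕ
    rowSize = sumFrom blockSize a span

    halves-sum : ∀ q → halfSize q + halfSize (not q) ≡ rowSize
    halves-sum false = paritySum-split blockSize a span
    halves-sum true  = trans (+-comm (halfSize true) _) (paritySum-split blockSize a span)

    rowSize-≡ : rowSize ≡ (span * L) ⊓ (n ∸ a * L)
    rowSize-≡ = trans (sym (sumFrom-blocks L (𝟙 ∘ present) a span)) (count-below n (a * L) (span * L))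

    RowTop : ℕ → Set
    RowTop y = (y ≤ prefixMass (suc i)) × (prefixMass (suc i) < y + L)

    rowTop-floor : RowTop (a * L + rowSize)
    rowTop-floor = atEnd end
      where
      rowSize-as : a * L + rowSize ≡ a * L + (E * L ∸ a * L) ⊓ (n ∸ a * L)
      rowSize-as = trans (cong (a * L +_) rowSize-≡) (cong (λ x → a * L + x ⊓ (n ∸ a * L)) (*-distribʳ-∸ L E a))
      aL≤EL : a * L ≤ E * L
      aL≤EL = *-monoˡ-≤ L a≤E
      atEnd : RowEnd i E → RowTop (a * L + rowSize)
      atEnd (inj₁ (i<ℓ′ , E≡)) = subst RowTop (sym top≡EL) (subst (λ e → RowTop (e * L)) (sym E≡)
                                   (floor≤ (prefixMass (suc i)) , <floor+L (prefixMass (suc i))))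
        where
        EL≤n : E * L ≤ n
        EL≤n = ≤-trans (subst (λ e → e * L ≤ prefixMass (suc i)) (sym E≡) (floor≤ (prefixMass (suc i))))
                       (prefixMass≤n (suc i) (s≤s (<⇒≤ i<ℓ′)))
        top≡EL : a * L + rowSize ≡ E * L
        top≡EL = trans rowSize-as (trans (cong (a * L +_) (m≤n⇒m⊓n≡m (∸-monoˡ-≤ (a * L) EL≤n))) (m+[n∸m]≡n aL≤EL))
      atEnd (inj₂ (i≡ℓ′ , E≡)) = subst RowTop (sym top≡n)
                                   (≤-reflexive (sym lastMass) , subst (_< n + L) (sym lastMass) (m<m+n n (s≤s z≤n)))
        where
        lastMass : prefixMass (suc i) ≡ n
        lastMass = trans (cong (prefixMass ∘ suc) i≡ℓ′) prefixMass-ℓ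
        aL≤n : a * L ≤ n
        aL≤n = ≤-trans (floor≤ (prefixMass i)) (prefixMass≤n i (≤-trans i≤ℓ′ (n≤1+n ℓ′)))
        n≤EL : n ≤ E * L
        n≤EL = subst (λ e → n ≤ e * L) (sym E≡) (m≤m*n n L)
        top≡n : a * L + rowSize ≡ n
        top≡n = trans rowSize-as (trans (cong (a * L +_) (m≥n⇒m⊓n≡n (∸-monoˡ-≤ (a * L) n≤EL))) (m+[n∸m]≡n aL≤n))

    rowSize-close : ∣ rowSize - rowMass i ∣ ≤ L
    rowSize-close = ∣-∣-gaps (floor≤ (prefixMass i)) (<floor+L (prefixMass i)) (proj₁ rowTop-floor) (proj₂ rowTop-floor)
                      refl (sym (sumFrom-snoc rowMass 0 i))

    columnCount-close-target : ∀ q k target → ∣ rowMass i - 2 * r * target ∣ ≤ 2 * r → ∣ columnCount q k - target ∣ ≤ 4 * L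
    columnCount-close-target q k target mass≈target =
      column-estimate r L (columnCount q k) target (halfSize q) (halfSize (not q)) (rowMass i) (s≤s z≤n) (s≤s z≤n)
        nearAverage (halves-close q) (subst (λ x → ∣ x - rowMass i ∣ ≤ L) (sym (halves-sum q)) rowSize-close) mass≈target
      where
      nearAverage : ∣ r * columnCount q k - halfSize q ∣ ≤ r * (2 * L)
      nearAverage = subst₂ (λ x y → ∣ x - y ∣ ≤ r * (2 * L)) (sumFrom-const (columnCount q k) 0 r) (columnCount-sum q)
        (∣-∣-sumFrom (λ _ → columnCount q k) (λ k′ → columnCount q (clamp r′ k′)) (2 * L) 0 r
          (λ k′ → columnCount-close q k (clamp r′ k′)))

  preimage-close : ∀ (i : Fin ℓ) j → ∣ preimageSize f (i , j) - m i j ∣ ≤ 4 * L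
  preimage-close i j with column-surjective j
  ... | q , k , refl = subst (λ s → ∣ s - m i (column q k) ∣ ≤ 4 * L) (sym (trans (preimage-cell i q k) (cellCount q k)))
                         (columnCount-close-target q k (m i (column q k)) (rowMass-close i (column q k)))
    where
    i≤ℓ′ : toℕ i ≤ ℓ′
    i≤ℓ′ = ≤-pred (toℕ<n i)
    open Row (toℕ i) i≤ℓ′ (proj₁ (rowEnd (toℕ i) i≤ℓ′)) (proj₂ (rowEnd (toℕ i) i≤ℓ′))

  preimage-close-ℚ : ∀ i j → ⟦ ∣ preimageSize f (i , j) - m i j ∣ ⟧ ≤ℚ ⟦ 10 ⟧ · β · ⟦ n ⟧
  preimage-close-ℚ i j = subst (⟦ ∣ preimageSize f (i , j) - m i j ∣ ⟧ ≤ℚ_) (sym (ℚP.*-assoc ⟦ 10 ⟧ β ⟦ n ⟧))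
    (⟦⟧-≤-scale 10 ∣ preimageSize f (i , j) - m i j ∣ L βn (≤-trans (preimage-close i j) (*-monoˡ-≤ L 4≤10)) L≤βn)
    where
    4≤10 : 4 ≤ 10
    4≤10 = s≤s (s≤s (s≤s (s≤s z≤n)))

lemma13 : (r ℓ Δ : ℕ) → r ≥ 1 → ℓ ≥ 1 → Δ ≥ 1 → (β : ℚ) → 0ℚ <ℚ β →
    Σ ℕ λ n₀ → (n : ℕ) → n ≥ 1 → n ≥ n₀ →
    (H : Graph n) → MaxDegree≤ H Δ →
    BandwidthAtMost H (β · ⟦ n ⟧) →
    (m : Fin ℓ → Fin (2 * r) → ℕ) →
    ΣFin ℓ (λ i → ΣFin (2 * r) (λ j → m i j)) ≡ n →
    (∀ i j → ⟦ 10 ⟧ · β · ⟦ n ⟧ ≤ℚ ⟦ m i j ⟧) →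
    (∀ i j j′ → ∣ m i j - m i j′ ∣ ≤ 1) →
    (χ : Fin n → Fin r) → ProperColouring H r χ →
    Σ (Fin n → Fin ℓ × Fin (2 * r)) λ f → Σ (Subset n) λ B →
      -- (B1)
      ((∀ (s : Fin n) → ⟦ toℕ s + 1 ⟧ ≤ℚ β · ⟦ n ⟧ → s ∉ B)
        × ⟦ ∣ B ∣ ⟧ ≤ℚ ⟦ 2 ⟧ · ⟦ ℓ ⟧ · β · ⟦ n ⟧)
      -- (B2)
      × (∀ i j → ⟦ ∣ preimageSize f (i , j) - m i j ∣ ⟧ ≤ℚ ⟦ 10 ⟧ · β · ⟦ n ⟧)
      -- (B3)
      × (∀ u v → Edge H u v →
          (∣ toℕ (proj₁ (f u)) - toℕ (proj₁ (f v)) ∣ ≤ 1)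
          × ¬ (proj₂ (f u) ≡ proj₂ (f v))
          × (u ∉ B → v ∉ B → proj₁ (f u) ≡ proj₁ (f v)))
      -- (B4)
      × (∀ (s : Fin n) → ⟦ toℕ s + 1 ⟧ ≤ℚ β · ⟦ n ⟧ → (toℕ (proj₁ (f s)) ≡ 0) × (proj₂ (f s) ≡ embCol (χ s)))
-- n₀ makes βn ≥ 1, so that blocks have length L ≥ 1.
lemma13 zero     _        _ () _  _ _ _
lemma13 (suc r′) zero     _ _  () _ _ _
lemma13 (suc r′) (suc ℓ′) _ _  _  _ β 0<β =
  n₀ , λ n 1≤n n₀≤n H _ bandwidth m m-total m-large m-even χ χ-proper →
    let open Construction r′ ℓ′ β 0<β n 1≤n (βn≥1 n n₀≤n) H bandwidth m m-total m-large m-even χ χ-proper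
    in f , B , (initial-∉B , ∣B∣≤2ℓβn) , preimage-close-ℚ , edgeOK , initial-f
  where
  open NatInRationals using (archimedean)
  n₀ : ℕ
  n₀ = proj₁ (archimedean β 0<β)
  βn≥1 : ∀ n → n₀ ≤ n → ⟦ 1 ⟧ ≤ℚ β · ⟦ n ⟧
  βn≥1 = proj₂ (archimedean β 0<β)
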